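{- For every $n\ge1$, the set $\{\Theta(T): T\in\mathcal{T}Lyn_n^\bullet\}$ is a basis of $\mathcal{P}re\mathcal{L}ie(n)$.
   Context: A pre-Lie algebra is a vector space $V$ with a bilinear operation $\circ$ satisfying $(v\circ w)\circ z-v\circ(w\circ z)=(v\circ z)\circ w-v\circ(z\circ w)$ for all $v,w,z\in V$. $\mathcal{P}re\mathcal{L}ie(n)$ is the multilinear component of the free pre-Lie algebra on generators $1,\dots,n$ (the span of monomials in which each generator appears exactly once). Trees: a bicolored binary tree on $[n]$ is a rooted planar binary tree (left child $L(v)$, right child $R(v)$ of each internal vertex) with leaves bijectively labeled by $[n]$ and internal vertices colored in $\{0,1\}$. $\nu(v)$ is the smallest leaf label below $v$; normalized means $\nu(v)=\nu(L(v))$ for all internal $v$; $v$ is Lyndon if $L(v)$ is a leaf or $\nu(R(L(v)))>\nu(R(v))$. A normalized bicolored binary tree is a pointed Lyndon tree if every internal $v$ with internal left child satisfies $\mathrm{color}(L(v))\ge\mathrm{color}(v)$ and, when $\mathrm{color}(L(v))=\mathrm{color}(v)=1$, $v$ is Lyndon. $\mathcal{T}Lyn_n^\bullet$ denotes the set of pointed Lyndon trees with leaf label set $[n]$. Writing $T=T_L\wedge^u T_R$ for a tree with left subtree $T_L$, right subtree $T_R$ and root color $u$, define $\Theta(T)\in\mathcal{P}re\mathcal{L}ie(n)$ recursively by $\Theta(a)=a$ for a single leaf $a$, $\Theta(T)=\Theta(T_L)\circ\Theta(T_R)$ if $u=1$, and $\Theta(T)=\Theta(T_R)\circ\Theta(T_L)$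 if $u=0$. -}

module Defs where

open import Level using (_⊔_; suc)
open import Algebra.Bundles using (CommutativeRing)
open import Data.Nat as ℕ using (ℕ; _⊔_; _⊓_; _<_)
open import Data.Fin as Fin using (Fin; zero; suc; toℕ)
open import Data.List using (List; []; _∷_; _++_; map; concatMap)
open import Data.Product using (_×_; _,_; Σ; ∃)
open import Data.Unit using (⊤)
open import Relation.Nullary using (¬_; Dec; yes; no)
open import Relation.Binary.PropositionalEquality using (_≡_; refl; cong₂)
open import Data.List using (allFin)
open import Data.List.Relation.Binary.Permutation.Propositional using (_↭_)

record Field (c ℓ : Level.Level) : Set (Level.suc (c Level.⊔ ℓ)) where
  field
    commutativeRing : CommutativeRing c ℓ
  open CommutativeRing commutativeRing public
  field
    0≉1     : ¬ (0# ≈ 1#)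
    inverse : ∀ x → ¬ (x ≈ 0#) → ∃ λ y → (x * y) ≈ 1#

data Mag (n : ℕ) : Set where
  gen  : Fin n → Mag n
  _·_  : Mag n → Mag n → Mag n

infixl 7 _·_

private
  gen-inj : ∀ {n} {a b : Fin n} → gen a ≡ gen b → a ≡ b
  gen-inj refl = refl
  ·-injˡ : ∀ {n} {a b c d : Mag n} → a · b ≡ c · d → a ≡ c
  ·-injˡ refl = refl
  ·-injʳ : ∀ {n} {a b c d : Mag n} → a · b ≡ c · d → b ≡ d
  ·-injʳ refl = refl

_≟ᴹ_ : ∀ {n} (a b : Mag n) → Dec (a ≡ b)
gen a ≟ᴹ gen b with a Fin.≟ b
... | yes refl = yes refl
... | no ne = no λ e → ne (gen-inj e)
gen a ≟ᴹ (b · c) = no λ ()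
(a · b) ≟ᴹ gen c = no λ ()
(a · b) ≟ᴹ (c · d) with a ≟ᴹ c | b ≟ᴹ d
... | yes refl | yes refl = yes refl
... | no ne | _ = no λ e → ne (·-injˡ e)
... | yes _ | no ne = no λ e → ne (·-injʳ e)

magLeaves : ∀ {n} → Mag n → List (Fin n)
magLeaves (gen a) = a ∷ []
magLeaves (a · b) = magLeaves a ++ magLeaves b

data Ctx (n : ℕ) : Set where
  hole : Ctx n
  _◁_  : Ctx n → Mag n → Ctx n
  _▷_  : Mag n → Ctx n → Ctx n

plug : ∀ {n} → Ctx n → Mag n → Mag n
plug hole      x = x
plug (C ◁ m)   x = plug C x · m
plug (m ▷ C)   x = m · plug C x

module FreeAlgebra {c ℓ} (F : Field c ℓ) where
  open Field F

  -- Elements of the free magma algebra F{Mag n}: formal finite linear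
  -- combinations of monomials, compared via their coefficient functions.
  Lin : ℕ → Set c
  Lin n = List (Carrier × Mag n)

  coef : ∀ {n} → Lin n → Mag n → Carrier
  coef []            m = 0#
  coef ((k , x) ∷ v) m with x ≟ᴹ m
  ... | yes _ = k + coef v m
  ... | no  _ = coef v m

  _≈ᴸ_ : ∀ {n} → Lin n → Lin n → Set ℓ
  u ≈ᴸ v = ∀ m → coef u m ≈ coef v m

  scale : ∀ {n} → Carrier → Lin n → Lin n
  scale k = map (λ { (a , x) → (k * a , x) })

  mapMon : ∀ {n} → (Mag n → Mag n) → Lin n → Lin n
  mapMon f = map (λ { (a , x) → (a , f x) })

  _−ᴸ_ : ∀ {n} → Lin n → Lin n → Lin n
  u −ᴸ v = u ++ scale (- 1#) v

  relator : ∀ {n} → Mag n → Mag n → Mag n → Lin n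
  relator a b d =
    (1# , (a · b) · d) ∷ (- 1# , a · (b · d)) ∷
    (- 1# , (a · d) · b) ∷ (1# , a · (d · b)) ∷ []

  -- generators of the two-sided ideal of the pre-Lie relations:
  -- the relator placed in an arbitrary monomial context
  IdealGen : ℕ → Set c
  IdealGen n = Carrier × Ctx n × Mag n × Mag n × Mag n

  evalGens : ∀ {n} → List (IdealGen n) → Lin n
  evalGens = concatMap (λ { (k , C , a , b , d) → scale k (mapMon (plug C) (relator a b d)) })

  -- membership in the pre-Lie ideal I_n of the free magma algebra;
  -- PreLie on generators 1..n is F{Mag n} / I_n.
  InIdeal : ∀ {n} → Lin n → Set (c Level.⊔ ℓ)
  InIdeal {n} v = ∃ λ (gs : List (IdealGen n)) → v ≈ᴸ evalGens gs

data BTree (n : ℕ) : Set where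
  leaf : Fin n → BTree n
  node : Fin 2 → BTree n → BTree n → BTree n   -- node u L R  =  L ∧^u R

leaves : ∀ {n} → BTree n → List (Fin n)
leaves (leaf a) = a ∷ []
leaves (node _ l r) = leaves l ++ leaves r

ν : ∀ {n} → BTree n → ℕ
ν (leaf a) = toℕ a
ν (node _ l r) = ν l ⊓ ν r

IsLyndon : ∀ {n} → BTree n → BTree n → Set
IsLyndon (leaf _) r = ⊤
IsLyndon (node _ _ lr) r = ν r < ν lr

PLLocal : ∀ {n} → Fin 2 → BTree n → BTree n → Set
PLLocal u (leaf _) r = ⊤
PLLocal u l@(node u' _ _) r =
  (u Fin.≤ u') × (u' ≡ Fin.suc Fin.zero → u ≡ Fin.suc Fin.zero → IsLyndon l r)

IsPointedLyndon : ∀ {n} → BTree n → Set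
IsPointedLyndon (leaf _) = ⊤
IsPointedLyndon (node u l r) =
  (ν (node u l r) ≡ ν l) × PLLocal u l r × IsPointedLyndon l × IsPointedLyndon r

Θ : ∀ {n} → BTree n → Mag n
Θ (leaf a) = gen a
Θ (node Fin.zero l r) = Θ r · Θ l
Θ (node (Fin.suc _) l r) = Θ l · Θ r

Multilinear : ∀ {n} → Mag n → Set
Multilinear {n} m = magLeaves m ↭ allFin n

InTLyn : (n : ℕ) → BTree n → Set
InTLyn n T = IsPointedLyndon T × (leaves T ↭ allFin n)

module ThetaComb {c ℓ} (F : Field c ℓ) where
  open Field F
  open FreeAlgebra F
  ΘLin : ∀ {n} → List (Carrier × BTree n) → Lin n
  ΘLin = map (λ { (k , T) → (k , Θ T) })

{-# OPTIONS --safe #-}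
-- Spanning: a product Θ B · Θ B' of pointed Lyndon trees on disjoint labels is either Θ of a pointed Lyndon tree
-- or is rewritten, by the pre-Lie relation at the root of B, into products that are smaller for the number of
-- labels of B below ν B'; every multilinear monomial is then expanded recursively.
--
-- Independence: send a monomial to its image in the pre-Lie algebra of rooted trees (Chapoton–Livernet) and
-- read off the coefficient of a fixed rooted tree P; this kills the pre-Lie ideal. Let P_T be the leading tree
-- of Θ T, obtained by grafting the right factor onto the root of the left one at every product. Then Θ T has
-- coefficient 1 at P_T, and the pointed Lyndon conditions force any other Θ T' with a nonzero coefficient at
-- P_T to have strictly smaller total depth. The coefficient matrix is thus unitriangular, in any characteristic.

module Submission where

open import Defs
open import Data.Nat using (ℕ; _≤_)
open import Data.Product using (_×_; _,_; ∃; proj₁; proj₂)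
open import Data.List using (List; []; _∷_; map)
open import Data.List.Relation.Unary.All using (All)
open import Data.List.Relation.Unary.Unique.Propositional using (Unique)
import Data.Fin as Fin

pattern 𝟙 = Fin.suc Fin.zero

module Occurrences where

  open import Data.Nat as ℕ using (ℕ; zero; suc; _+_; _≤_; _<_; z≤n; s≤s; _⊓_)
  open import Data.Nat.Properties
  open import Data.Fin as Fin using (Fin; toℕ)
  open import Data.List using (List; []; _∷_; _++_; allFin; tabulate)
  open import Data.List.Relation.Binary.Permutation.Propositional using (_↭_; refl; prep; swap; trans)
  open import Data.Product using (_×_; _,_; Σ)
  open import Data.Sum using (_⊎_; inj₁; inj₂)
  open import Relation.Nullary using (Dec; yes; no)
  open import Relation.Binary.PropositionalEquality as ≡ using (_≡_; _≢_; cong; cong₂; subst)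
  open import Data.Empty using (⊥; ⊥-elim)
  open import Data.Fin.Properties using (toℕ-injective)
  open import Function using (_∘_)

  1≤+⇒1≤⊎1≤ : ∀ x y → 1 ≤ x + y → (1 ≤ x) ⊎ (1 ≤ y)
  1≤+⇒1≤⊎1≤ zero y h = inj₂ h
  1≤+⇒1≤⊎1≤ (suc x) y h = inj₁ (s≤s z≤n)

  +≤1⇒absentʳ : ∀ x y → x + y ≤ 1 → 1 ≤ x → y ≡ 0
  +≤1⇒absentʳ (suc x) zero h hx = ≡.refl
  +≤1⇒absentʳ (suc x) (suc y) (s≤s h) _ with m+n≤o⇒n≤o x h
  ... | ()

  1≰0 : 1 ≤ 0 → ⊥
  1≰0 ()

  ≤1-≡ : ∀ {x y} → x ≤ 1 → y ≤ 1 → (1 ≤ x → 1 ≤ y) → (1 ≤ y → 1 ≤ x) → x ≡ y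
  ≤1-≡ {zero} {zero} _ _ f g = ≡.refl
  ≤1-≡ {zero} {suc y} _ _ f g with g (s≤s z≤n)
  ... | ()
  ≤1-≡ {suc x} {zero} _ _ f g with f (s≤s z≤n)
  ... | ()
  ≤1-≡ {suc zero} {suc zero} _ _ f g = ≡.refl
  ≤1-≡ {suc (suc x)} {_} (s≤s ()) _ f g
  ≤1-≡ {suc zero} {suc (suc y)} _ (s≤s ()) f g

  ≡0⊎1≤ : ∀ k → (k ≡ 0) ⊎ (1 ≤ k)
  ≡0⊎1≤ zero = inj₁ ≡.refl
  ≡0⊎1≤ (suc k) = inj₂ (s≤s z≤n)

  +<suc⇒<ʳ : ∀ x y k → 1 ≤ x → x + y < suc k → y < k
  +<suc⇒<ʳ (suc x) y k _ (s≤s h) = ≤-trans (s≤s (m≤n+m y x)) h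

  +<suc⇒<ˡ : ∀ x y k → 1 ≤ y → x + y < suc k → x < k
  +<suc⇒<ˡ x y k h1 h = +<suc⇒<ʳ y x k h1 (subst (_< suc k) (+-comm x y) h)

  indicator : ∀ {p} {P : Set p} → Dec P → ℕ
  indicator (yes _) = 1
  indicator (no _) = 0

  indicator-yes : ∀ {p} {P : Set p} (d : Dec P) → P → indicator d ≡ 1
  indicator-yes (yes _) _ = ≡.refl
  indicator-yes (no ¬p) p = ⊥-elim (¬p p)

  indicator-pos : ∀ {p} {P : Set p} (d : Dec P) → 1 ≤ indicator d → P
  indicator-pos (yes p) _ = p

  indicator≤1 : ∀ {p} {P : Set p} (d : Dec P) → indicator d ≤ 1
  indicator≤1 (yes _) = s≤s z≤n
  indicator≤1 (no _) = z≤n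

  module _ {a p} {A : Set a} {P : A → Set p} (P? : ∀ x → Dec (P x)) where

    count : List A → ℕ
    count [] = 0
    count (x ∷ xs) = indicator (P? x) + count xs

    count-++ : ∀ xs ys → count (xs ++ ys) ≡ count xs + count ys
    count-++ [] ys = ≡.refl
    count-++ (x ∷ xs) ys = ≡.trans (cong (indicator (P? x) +_) (count-++ xs ys)) (≡.sym (+-assoc (indicator (P? x)) _ _))

    count-↭ : ∀ {xs ys} → xs ↭ ys → count xs ≡ count ys
    count-↭ refl = ≡.refl
    count-↭ (prep x p) = cong (indicator (P? x) +_) (count-↭ p)
    count-↭ (swap {xs = xs} {ys = ys} x y p) = begin
      indicator (P? x) + (indicator (P? y) + count xs) ≡⟨ ≡.sym (+-assoc (indicator (P? x)) _ _) ⟩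
      (indicator (P? x) + indicator (P? y)) + count xs ≡⟨ cong₂ _+_ (+-comm (indicator (P? x)) _) (count-↭ p) ⟩
      (indicator (P? y) + indicator (P? x)) + count ys ≡⟨ +-assoc (indicator (P? y)) _ _ ⟩
      indicator (P? y) + (indicator (P? x) + count ys) ∎
      where open ≡.≡-Reasoning
    count-↭ (trans p q) = ≡.trans (count-↭ p) (count-↭ q)

  module _ {n : ℕ} {p} {P : Fin n → Set p} (P? : ∀ x → Dec (P x)) where

    countᵀ : BTree n → ℕ
    countᵀ (leaf a) = indicator (P? a)
    countᵀ (node _ l r) = countᵀ l + countᵀ r

    countᵀ-leaves : ∀ T → countᵀ T ≡ count P? (leaves T)
    countᵀ-leaves (leaf b) = ≡.sym (+-identityʳ _)
    countᵀ-leaves (node _ l r) = ≡.trans (cong₂ _+_ (countᵀ-leaves l) (countᵀ-leaves r)) (≡.sym (count-++ P? (leaves l) (leaves r)))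

    countᵀ-↭ : ∀ T T' → leaves T ↭ leaves T' → countᵀ T ≡ countᵀ T'
    countᵀ-↭ T T' p = ≡.trans (countᵀ-leaves T) (≡.trans (count-↭ P? p) (≡.sym (countᵀ-leaves T')))

    countᵀ-↭++ : ∀ K A B → leaves K ↭ leaves A ++ leaves B → countᵀ K ≡ countᵀ A + countᵀ B
    countᵀ-↭++ K A B = countᵀ-↭ K (node Fin.zero A B)

  occ : ∀ {n} → Fin n → List (Fin n) → ℕ
  occ a = count (a Fin.≟_)

  occᵀ : ∀ {n} → Fin n → BTree n → ℕ
  occᵀ a = countᵀ (a Fin.≟_)

  occᴹ : ∀ {n} → Fin n → Mag n → ℕ
  occᴹ a (gen b) = indicator (a Fin.≟ b)
  occᴹ a (x · y) = occᴹ a x + occᴹ a y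

  _∈ᵀ_ : ∀ {n} → Fin n → BTree n → Set
  a ∈ᵀ T = 1 ≤ occᵀ a T

  _∈ᴹ_ : ∀ {n} → Fin n → Mag n → Set
  a ∈ᴹ m = 1 ≤ occᴹ a m

  infix 4 _∈ᵀ_ _∈ᴹ_

  belowᵀ : ∀ {n} → BTree n → ℕ → ℕ
  belowᵀ T v = countᵀ (λ x → toℕ x ℕ.<? v) T

  occᴹ-magLeaves : ∀ {n} (a : Fin n) m → occᴹ a m ≡ occ a (magLeaves m)
  occᴹ-magLeaves a (gen b) = ≡.sym (+-identityʳ _)
  occᴹ-magLeaves a (x · y) = ≡.trans (cong₂ _+_ (occᴹ-magLeaves a x) (occᴹ-magLeaves a y)) (≡.sym (count-++ (a Fin.≟_) (magLeaves x) (magLeaves y)))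

  occᵀ-Θ : ∀ {n} (a : Fin n) T → occᵀ a T ≡ occᴹ a (Θ T)
  occᵀ-Θ a (leaf b) = ≡.refl
  occᵀ-Θ a (node Fin.zero l r) = ≡.trans (+-comm (occᵀ a l) (occᵀ a r)) (cong₂ _+_ (occᵀ-Θ a r) (occᵀ-Θ a l))
  occᵀ-Θ a (node (Fin.suc _) l r) = cong₂ _+_ (occᵀ-Θ a l) (occᵀ-Θ a r)

  occ-tabulate-suc : ∀ {n m} (a : Fin n) (f : Fin m → Fin n) → occ (Fin.suc a) (tabulate (Fin.suc ∘ f)) ≡ occ a (tabulate f)
  occ-tabulate-suc {m = zero} a f = ≡.refl
  occ-tabulate-suc {m = suc m} a f with a Fin.≟ f Fin.zero
  ... | yes ≡.refl = cong suc (occ-tabulate-suc a (f ∘ Fin.suc))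
  ... | no _ = occ-tabulate-suc a (f ∘ Fin.suc)

  occ-zero-tabulate-suc : ∀ {n m} (f : Fin m → Fin n) → occ Fin.zero (tabulate (Fin.suc ∘ f)) ≡ 0
  occ-zero-tabulate-suc {m = zero} f = ≡.refl
  occ-zero-tabulate-suc {m = suc m} f = occ-zero-tabulate-suc (f ∘ Fin.suc)

  occ-allFin : ∀ {n} (a : Fin n) → occ a (allFin n) ≡ 1
  occ-allFin {suc n} Fin.zero = cong suc (occ-zero-tabulate-suc {n} (λ x → x))
  occ-allFin {suc n} (Fin.suc a) = ≡.trans (occ-tabulate-suc a (λ x → x)) (occ-allFin a)

  ν≤occurring : ∀ {n} (a : Fin n) T → a ∈ᵀ T → ν T ≤ toℕ a
  ν≤occurring a (leaf b) h rewrite indicator-pos (a Fin.≟ b) h = ≤-refl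
  ν≤occurring a (node _ l r) h with 1≤+⇒1≤⊎1≤ (occᵀ a l) (occᵀ a r) h
  ... | inj₁ hl = ≤-trans (m⊓n≤m (ν l) (ν r)) (ν≤occurring a l hl)
  ... | inj₂ hr = ≤-trans (m⊓n≤n (ν l) (ν r)) (ν≤occurring a r hr)

  ν-attained : ∀ {n} T → Σ (Fin n) λ a → (a ∈ᵀ T) × (ν T ≡ toℕ a)
  ν-attained (leaf b) = b , ≤-reflexive (≡.sym (indicator-yes (b Fin.≟ b) ≡.refl)) , ≡.refl
  ν-attained (node _ l r) with ≤-total (ν l) (ν r)
  ... | inj₁ le = let (a , h , e) = ν-attained l in a , ≤-trans h (m≤m+n _ _) , ≡.trans (m≤n⇒m⊓n≡m le) e
  ... | inj₂ ge = let (a , h , e) = ν-attained r in a , ≤-trans h (m≤n+m _ _) , ≡.trans (m≥n⇒m⊓n≡n ge) e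

  ν-cong : ∀ {n} (T T' : BTree n) → (∀ a → occᵀ a T ≡ occᵀ a T') → ν T ≡ ν T'
  ν-cong T T' e = ≤-antisym (ν-mono T T' e) (ν-mono T' T (λ a → ≡.sym (e a)))
    where
    ν-mono : ∀ T T' → (∀ a → occᵀ a T ≡ occᵀ a T') → ν T ≤ ν T'
    ν-mono T T' e with ν-attained T'
    ... | a , h , e' = subst (ν T ≤_) (≡.sym e') (ν≤occurring a T (subst (1 ≤_) (≡.sym (e a)) h))

  ν-↭ : ∀ {n} (T T' : BTree n) → leaves T ↭ leaves T' → ν T ≡ ν T'
  ν-↭ T T' p = ν-cong T T' (λ a → countᵀ-↭ (a Fin.≟_) T T' p)

  ν-↭++ : ∀ {n} (K A B : BTree n) → leaves K ↭ leaves A ++ leaves B → ν K ≡ ν A ⊓ ν B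
  ν-↭++ K A B = ν-↭ K (node Fin.zero A B)

  Disjoint : ∀ {n} → BTree n → BTree n → Set
  Disjoint B B' = ∀ a → occᵀ a B + occᵀ a B' ≤ 1

  ν-disjoint-≢ : ∀ {n} (A C : BTree n) → Disjoint A C → ν A ≢ ν C
  ν-disjoint-≢ A C d e with ν-attained A | ν-attained C
  ... | a , ha , ea | c , hc , ec with toℕ-injective (≡.trans (≡.sym ea) (≡.trans e ec))
  ... | ≡.refl with +≤1⇒absentʳ (occᵀ a A) (occᵀ a C) (d a) ha
  ... | z rewrite z with hc
  ... | ()

  belowᵀ-pos : ∀ {n} (T : BTree n) v → ν T < v → 1 ≤ belowᵀ T v
  belowᵀ-pos (leaf a) v h with toℕ a ℕ.<? v
  ... | yes _ = s≤s z≤n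
  ... | no ne = ⊥-elim (ne h)
  belowᵀ-pos (node _ l r) v h with ≤-total (ν l) (ν r)
  ... | inj₁ le = ≤-trans (belowᵀ-pos l v (subst (_< v) (m≤n⇒m⊓n≡m le) h)) (m≤m+n _ _)
  ... | inj₂ ge = ≤-trans (belowᵀ-pos r v (subst (_< v) (m≥n⇒m⊓n≡n ge) h)) (m≤n+m _ _)

  belowᵀ-zero : ∀ {n} (T : BTree n) v → v ≤ ν T → belowᵀ T v ≡ 0
  belowᵀ-zero (leaf a) v h with toℕ a ℕ.<? v
  ... | yes lt = ⊥-elim (<⇒≱ lt h)
  ... | no _ = ≡.refl
  belowᵀ-zero (node _ l r) v h = cong₂ _+_ (belowᵀ-zero l v (≤-trans h (m⊓n≤m _ _))) (belowᵀ-zero r v (≤-trans h (m⊓n≤n _ _)))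

  belowᵀ-mono : ∀ {n} (T : BTree n) v w → v ≤ w → belowᵀ T v ≤ belowᵀ T w
  belowᵀ-mono (leaf a) v w h with toℕ a ℕ.<? v | toℕ a ℕ.<? w
  ... | yes _ | yes _ = ≤-refl
  ... | yes p | no q = ⊥-elim (q (<-≤-trans p h))
  ... | no _ | _ = z≤n
  belowᵀ-mono (node _ l r) v w h = +-mono-≤ (belowᵀ-mono l v w h) (belowᵀ-mono r v w h)

module DisjointTrees where

  open Occurrences
  open import Data.Nat using (ℕ; _+_; _≤_)
  open import Data.Nat.Properties using (≤-trans; m≤m+n; m≤n+m; +-comm; +-assoc; +-monoˡ-≤)
  open import Data.List using (_++_)
  open import Data.List.Relation.Binary.Permutation.Propositional using (_↭_)
  open import Relation.Binary.PropositionalEquality using (cong; subst; sym; trans)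

  module _ {n : ℕ} (L R B : BTree n) (d : ∀ a → (occᵀ a L + occᵀ a R) + occᵀ a B ≤ 1) where

    disjoint-left : Disjoint L B
    disjoint-left a = ≤-trans (+-monoˡ-≤ (occᵀ a B) (m≤m+n (occᵀ a L) (occᵀ a R))) (d a)

    disjoint-right : Disjoint R B
    disjoint-right a = ≤-trans (+-monoˡ-≤ (occᵀ a B) (m≤n+m (occᵀ a R) (occᵀ a L))) (d a)

    disjoint-children : Disjoint L R
    disjoint-children a = ≤-trans (m≤m+n (occᵀ a L + occᵀ a R) (occᵀ a B)) (d a)

    disjoint-assoc : Disjoint L (node Fin.zero R B)
    disjoint-assoc a = subst (_≤ 1) (+-assoc (occᵀ a L) (occᵀ a R) (occᵀ a B)) (d a)

    disjoint-regroupˡ : ∀ K → leaves K ↭ leaves L ++ leaves B → Disjoint K R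
    disjoint-regroupˡ K p a = subst (_≤ 1) (sym (begin
      occᵀ a K + occᵀ a R ≡⟨ cong (_+ occᵀ a R) (countᵀ-↭++ (a Fin.≟_) K L B p) ⟩
      (occᵀ a L + occᵀ a B) + occᵀ a R ≡⟨ +-assoc (occᵀ a L) _ _ ⟩
      occᵀ a L + (occᵀ a B + occᵀ a R) ≡⟨ cong (occᵀ a L +_) (+-comm (occᵀ a B) _) ⟩
      occᵀ a L + (occᵀ a R + occᵀ a B) ≡⟨ sym (+-assoc (occᵀ a L) _ _) ⟩
      (occᵀ a L + occᵀ a R) + occᵀ a B ∎)) (d a)
      where open Relation.Binary.PropositionalEquality.≡-Reasoning

    disjoint-regroupʳ : ∀ K → leaves K ↭ leaves R ++ leaves B → Disjoint L K
    disjoint-regroupʳ K p a = subst (_≤ 1) (sym (trans (cong (occᵀ a L +_) (countᵀ-↭++ (a Fin.≟_) K R B p))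
      (sym (+-assoc (occᵀ a L) (occᵀ a R) (occᵀ a B))))) (d a)

module PreLieIdeal {c ℓ} (F : Field c ℓ) where

  open import Data.Nat as ℕ using (ℕ)
  open import Data.List using (List; []; _∷_; _++_; map)
  open import Data.List.Properties using (map-++)
  open import Data.Maybe using (Maybe; just; nothing; maybe)
  open import Data.Product using (_,_)
  open import Relation.Nullary using (Dec; yes; no)
  import Relation.Binary.PropositionalEquality as ≡
  open ≡ using (_≡_; _≢_)
  open import Data.Empty using (⊥-elim)
  import Level

  open Field F
  open FreeAlgebra F
  open ThetaComb F
  open import Relation.Binary.Reasoning.Setoid setoid
  open import Algebra.Properties.Ring ring using (-1*x≈-x)
  open import Algebra.Properties.CommutativeSemigroup +-commutativeSemigroup using () renaming (interchange to +-interchange)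
  open import Algebra.Properties.Group +-group using (⁻¹-involutive)

  −1# : Carrier
  −1# = - 1#

  x+−1x≈0 : ∀ x → x + −1# * x ≈ 0#
  x+−1x≈0 x = trans (+-congˡ (-1*x≈-x x)) (-‿inverseʳ x)

  −1-telescope : ∀ x y z → x + −1# * z ≈ (x + −1# * y) + (y + −1# * z)
  −1-telescope x y z = begin
    x + −1# * z ≈⟨ +-congʳ (sym (+-identityʳ x)) ⟩
    (x + 0#) + −1# * z ≈⟨ +-congʳ (+-congˡ (sym (trans (+-comm _ _) (x+−1x≈0 y)))) ⟩
    (x + (−1# * y + y)) + −1# * z ≈⟨ +-congʳ (sym (+-assoc x (−1# * y) y)) ⟩
    ((x + −1# * y) + y) + −1# * z ≈⟨ +-assoc _ y _ ⟩
    (x + −1# * y) + (y + −1# * z) ∎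

  −1-interchange : ∀ x x' y y' → (x + x') + −1# * (y + y') ≈ (x + −1# * y) + (x' + −1# * y')
  −1-interchange x x' y y' = trans (+-congˡ (distribˡ −1# y y')) (+-interchange x x' (−1# * y) (−1# * y'))

  −1-scale : ∀ k x y → k * x + −1# * (k * y) ≈ k * (x + −1# * y)
  −1-scale k x y = begin
    k * x + −1# * (k * y) ≈⟨ +-congˡ (sym (*-assoc −1# k y)) ⟩
    k * x + (−1# * k) * y ≈⟨ +-congˡ (*-congʳ (*-comm −1# k)) ⟩
    k * x + (k * −1#) * y ≈⟨ +-congˡ (*-assoc k −1# y) ⟩
    k * x + k * (−1# * y) ≈⟨ sym (distribˡ k x (−1# * y)) ⟩
    k * (x + −1# * y) ∎

  module _ {n : ℕ} where

    coef-++ : ∀ (u v : Lin n) m → coef (u ++ v) m ≈ coef u m + coef v m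
    coef-++ [] v m = sym (+-identityˡ _)
    coef-++ ((k , x) ∷ u) v m with x ≟ᴹ m
    ... | yes _ = trans (+-congˡ (coef-++ u v m)) (sym (+-assoc k _ _))
    ... | no _ = coef-++ u v m

    coef-scale : ∀ k (u : Lin n) m → coef (scale k u) m ≈ k * coef u m
    coef-scale k [] m = sym (zeroʳ k)
    coef-scale k ((a , x) ∷ u) m with x ≟ᴹ m
    ... | yes _ = trans (+-congˡ (coef-scale k u m)) (sym (distribˡ k a _))
    ... | no _ = coef-scale k u m

    coef-− : ∀ (u v : Lin n) m → coef (u −ᴸ v) m ≈ coef u m + −1# * coef v m
    coef-− u v m = trans (coef-++ u (scale −1# v) m) (+-congˡ (coef-scale −1# v m))

    coef-cons : ∀ {k k'} {u v : Lin n} x m → k ≈ k' → coef u m ≈ coef v m → coef ((k , x) ∷ u) m ≈ coef ((k' , x) ∷ v) m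
    coef-cons x m e f with x ≟ᴹ m
    ... | yes _ = +-cong e f
    ... | no _ = f

    ifYes : ∀ {p} {P : Set p} → Dec P → Carrier → Carrier
    ifYes (yes _) k = k
    ifYes (no _) k = 0#

    coef-∷ : ∀ k x (u : Lin n) m → coef ((k , x) ∷ u) m ≈ ifYes (x ≟ᴹ m) k + coef u m
    coef-∷ k x u m with x ≟ᴹ m
    ... | yes _ = refl
    ... | no _ = sym (+-identityˡ _)

    coef-swap : ∀ p q (u : Lin n) m → coef (p ∷ q ∷ u) m ≈ coef (q ∷ p ∷ u) m
    coef-swap (k , x) (k' , y) u m = begin
      coef ((k , x) ∷ (k' , y) ∷ u) m ≈⟨ coef-∷ k x _ m ⟩
      ifYes (x ≟ᴹ m) k + coef ((k' , y) ∷ u) m ≈⟨ +-congˡ (coef-∷ k' y u m) ⟩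
      ifYes (x ≟ᴹ m) k + (ifYes (y ≟ᴹ m) k' + coef u m) ≈⟨ sym (+-assoc _ _ _) ⟩
      (ifYes (x ≟ᴹ m) k + ifYes (y ≟ᴹ m) k') + coef u m ≈⟨ +-congʳ (+-comm _ _) ⟩
      (ifYes (y ≟ᴹ m) k' + ifYes (x ≟ᴹ m) k) + coef u m ≈⟨ +-assoc _ _ _ ⟩
      ifYes (y ≟ᴹ m) k' + (ifYes (x ≟ᴹ m) k + coef u m) ≈⟨ +-congˡ (sym (coef-∷ k x u m)) ⟩
      ifYes (y ≟ᴹ m) k' + coef ((k , x) ∷ u) m ≈⟨ sym (coef-∷ k' y _ m) ⟩
      coef ((k' , y) ∷ (k , x) ∷ u) m ∎

    _⊚_ : Ctx n → Ctx n → Ctx n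
    hole ⊚ D = D
    (C ◁ m) ⊚ D = (C ⊚ D) ◁ m
    (m ▷ C) ⊚ D = m ▷ (C ⊚ D)

    plug-⊚ : ∀ C D x → plug (C ⊚ D) x ≡ plug C (plug D x)
    plug-⊚ hole D x = ≡.refl
    plug-⊚ (C ◁ m) D x = ≡.cong (_· m) (plug-⊚ C D x)
    plug-⊚ (m ▷ C) D x = ≡.cong (m ·_) (plug-⊚ C D x)

    unplug : Ctx n → Mag n → Maybe (Mag n)
    unplug hole m = just m
    unplug (C ◁ m) (gen _) = nothing
    unplug (C ◁ m) (p · q) with q ≟ᴹ m
    ... | yes _ = unplug C p
    ... | no _ = nothing
    unplug (m ▷ C) (gen _) = nothing
    unplug (m ▷ C) (p · q) with p ≟ᴹ m
    ... | yes _ = unplug C q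
    ... | no _ = nothing

    unplug-plug : ∀ C x → unplug C (plug C x) ≡ just x
    unplug-plug hole x = ≡.refl
    unplug-plug (C ◁ m) x with m ≟ᴹ m
    ... | yes _ = unplug-plug C x
    ... | no ne = ⊥-elim (ne ≡.refl)
    unplug-plug (m ▷ C) x with m ≟ᴹ m
    ... | yes _ = unplug-plug C x
    ... | no ne = ⊥-elim (ne ≡.refl)

    plug-unplug : ∀ C m x → unplug C m ≡ just x → plug C x ≡ m
    plug-unplug hole m x ≡.refl = ≡.refl
    plug-unplug (C ◁ m') (gen _) x ()
    plug-unplug (C ◁ m') (p · q) x e with q ≟ᴹ m'
    ... | yes ≡.refl = ≡.cong (_· q) (plug-unplug C p x e)
    plug-unplug (C ◁ m') (p · q) x () | no _
    plug-unplug (m' ▷ C) (gen _) x ()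
    plug-unplug (m' ▷ C) (p · q) x e with p ≟ᴹ m'
    ... | yes ≡.refl = ≡.cong (p ·_) (plug-unplug C q x e)
    plug-unplug (m' ▷ C) (p · q) x () | no _

    coef-mapMon : ∀ C (u : Lin n) m → coef (mapMon (plug C) u) m ≈ maybe (coef u) 0# (unplug C m)
    coef-mapMon C [] m with unplug C m
    ... | just _ = refl
    ... | nothing = refl
    coef-mapMon C ((k , x) ∷ u) m with plug C x ≟ᴹ m
    ... | yes ≡.refl rewrite unplug-plug C x with x ≟ᴹ x
    ...   | yes _ = +-congˡ (trans (coef-mapMon C u (plug C x)) (≡.subst (λ z → maybe (coef u) 0# z ≈ coef u x) (≡.sym (unplug-plug C x)) refl))
    ...   | no ne = ⊥-elim (ne ≡.refl)
    coef-mapMon C ((k , x) ∷ u) m | no ne with unplug C m in eq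
    ... | nothing = trans (coef-mapMon C u m) (≡.subst (λ z → maybe (coef u) 0# z ≈ 0#) (≡.sym eq) refl)
    ... | just y with x ≟ᴹ y
    ...   | yes ≡.refl = ⊥-elim (ne (plug-unplug C m x eq))
    ...   | no _ = trans (coef-mapMon C u m) (≡.subst (λ z → maybe (coef u) 0# z ≈ coef u y) (≡.sym eq) refl)

    mapMon-≈ : ∀ C {u v : Lin n} → u ≈ᴸ v → mapMon (plug C) u ≈ᴸ mapMon (plug C) v
    mapMon-≈ C {u} {v} e m = trans (coef-mapMon C u m) (trans (lem (unplug C m)) (sym (coef-mapMon C v m)))
      where
      lem : ∀ z → maybe (coef u) 0# z ≈ maybe (coef v) 0# z
      lem (just y) = e y
      lem nothing = refl

    evalGen : IdealGen n → Lin n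
    evalGen (k , C , a , b , d) = scale k (mapMon (plug C) (relator a b d))

    coef-evalGens-++ : ∀ (gs hs : List (IdealGen n)) m → coef (evalGens (gs ++ hs)) m ≈ coef (evalGens gs) m + coef (evalGens hs) m
    coef-evalGens-++ [] hs m = sym (+-identityˡ _)
    coef-evalGens-++ (g ∷ gs) hs m = begin
      coef (evalGen g ++ evalGens (gs ++ hs)) m ≈⟨ coef-++ (evalGen g) _ m ⟩
      coef (evalGen g) m + coef (evalGens (gs ++ hs)) m ≈⟨ +-congˡ (coef-evalGens-++ gs hs m) ⟩
      coef (evalGen g) m + (coef (evalGens gs) m + coef (evalGens hs) m) ≈⟨ sym (+-assoc _ _ _) ⟩
      (coef (evalGen g) m + coef (evalGens gs) m) + coef (evalGens hs) m ≈⟨ +-congʳ (sym (coef-++ (evalGen g) _ m)) ⟩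
      coef (evalGen g ++ evalGens gs) m + coef (evalGens hs) m ∎

    ideal-nil : InIdeal {n} []
    ideal-nil = [] , λ m → refl

    ideal-resp : ∀ (u v : Lin n) → u ≈ᴸ v → InIdeal v → InIdeal u
    ideal-resp u v e (gs , f) = gs , λ m → trans (e m) (f m)

    ideal-++ : ∀ (u v : Lin n) → InIdeal u → InIdeal v → InIdeal (u ++ v)
    ideal-++ u v (gs , e) (hs , f) = gs ++ hs , λ m →
      trans (coef-++ u v m) (trans (+-cong (e m) (f m)) (sym (coef-evalGens-++ gs hs m)))

    scaleGens : Carrier → List (IdealGen n) → List (IdealGen n)
    scaleGens k = map (λ { (k' , C , a , b , d) → (k * k' , C , a , b , d) })

    coef-scaleGens : ∀ k gs m → coef (evalGens (scaleGens k gs)) m ≈ k * coef (evalGens gs) m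
    coef-scaleGens k [] m = sym (zeroʳ k)
    coef-scaleGens k ((k' , C , a , b , d) ∷ gs) m = begin
      coef (scale (k * k') W ++ evalGens (scaleGens k gs)) m ≈⟨ coef-++ (scale (k * k') W) _ m ⟩
      coef (scale (k * k') W) m + coef (evalGens (scaleGens k gs)) m ≈⟨ +-cong (coef-scale (k * k') W m) (coef-scaleGens k gs m) ⟩
      (k * k') * coef W m + k * coef (evalGens gs) m ≈⟨ +-congʳ (*-assoc k k' _) ⟩
      k * (k' * coef W m) + k * coef (evalGens gs) m ≈⟨ sym (distribˡ k _ _) ⟩
      k * (k' * coef W m + coef (evalGens gs) m) ≈⟨ *-congˡ (+-congʳ (sym (coef-scale k' W m))) ⟩
      k * (coef (scale k' W) m + coef (evalGens gs) m) ≈⟨ *-congˡ (sym (coef-++ (scale k' W) _ m)) ⟩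
      k * coef (scale k' W ++ evalGens gs) m ∎
      where
      W : Lin n
      W = mapMon (plug C) (relator a b d)

    ideal-scale : ∀ k (u : Lin n) → InIdeal u → InIdeal (scale k u)
    ideal-scale k u (gs , e) = scaleGens k gs , λ m →
      trans (coef-scale k u m) (trans (*-congˡ (e m)) (sym (coef-scaleGens k gs m)))

    ctxGens : Ctx n → List (IdealGen n) → List (IdealGen n)
    ctxGens C = map (λ { (k' , D , a , b , d) → (k' , C ⊚ D , a , b , d) })

    mapMon-scale : ∀ f k (u : Lin n) → mapMon f (scale k u) ≡ scale k (mapMon f u)
    mapMon-scale f k [] = ≡.refl
    mapMon-scale f k ((a , x) ∷ u) = ≡.cong ((k * a , f x) ∷_) (mapMon-scale f k u)

    mapMon-⊚ : ∀ C D k (u : Lin n) → mapMon (plug C) (scale k (mapMon (plug D) u)) ≡ scale k (mapMon (plug (C ⊚ D)) u)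
    mapMon-⊚ C D k [] = ≡.refl
    mapMon-⊚ C D k ((a , x) ∷ u) = ≡.cong₂ (λ z w → (k * a , z) ∷ w) (≡.sym (plug-⊚ C D x)) (mapMon-⊚ C D k u)

    mapMon-evalGens : ∀ C gs → mapMon (plug C) (evalGens gs) ≡ evalGens (ctxGens C gs)
    mapMon-evalGens C [] = ≡.refl
    mapMon-evalGens C ((k , D , a , b , d) ∷ gs) = ≡.trans (map-++ _ (scale k (mapMon (plug D) (relator a b d))) _)
      (≡.cong₂ _++_ (mapMon-⊚ C D k (relator a b d)) (mapMon-evalGens C gs))

    ideal-ctx : ∀ C (u : Lin n) → InIdeal u → InIdeal (mapMon (plug C) u)
    ideal-ctx C u (gs , e) = ctxGens C gs , λ m → trans (mapMon-≈ C {u} {evalGens gs} e m) (≡.subst (λ z → coef (mapMon (plug C) (evalGens gs)) m ≈ coef z m) (mapMon-evalGens C gs) refl)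

    record _∼_ (u v : Lin n) : Set (c Level.⊔ ℓ) where
      constructor mk∼
      field get : InIdeal (u −ᴸ v)
    open _∼_ public

    ≈ᴸ→∼ : ∀ {u v : Lin n} → u ≈ᴸ v → u ∼ v
    ≈ᴸ→∼ {u} {v} e = mk∼ (ideal-resp (u −ᴸ v) [] (λ m → trans (coef-− u v m) (trans (+-congʳ (e m)) (x+−1x≈0 _))) ideal-nil)

    ∼-refl : ∀ {u : Lin n} → u ∼ u
    ∼-refl {u} = ≈ᴸ→∼ {u} {u} (λ m → refl)

    ∼-trans : ∀ {u v w : Lin n} → u ∼ v → v ∼ w → u ∼ w
    ∼-trans {u} {v} {w} (mk∼ h) (mk∼ h') = mk∼ (ideal-resp (u −ᴸ w) ((u −ᴸ v) ++ (v −ᴸ w)) (λ m → begin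
      coef (u −ᴸ w) m ≈⟨ coef-− u w m ⟩
      coef u m + −1# * coef w m ≈⟨ −1-telescope _ (coef v m) _ ⟩
      (coef u m + −1# * coef v m) + (coef v m + −1# * coef w m) ≈⟨ sym (+-cong (coef-− u v m) (coef-− v w m)) ⟩
      coef (u −ᴸ v) m + coef (v −ᴸ w) m ≈⟨ sym (coef-++ (u −ᴸ v) _ m) ⟩
      coef ((u −ᴸ v) ++ (v −ᴸ w)) m ∎) (ideal-++ (u −ᴸ v) (v −ᴸ w) h h'))

    ∼-++ : ∀ {u v u' v' : Lin n} → u ∼ v → u' ∼ v' → (u ++ u') ∼ (v ++ v')
    ∼-++ {u} {v} {u'} {v'} (mk∼ h) (mk∼ h') = mk∼ (ideal-resp ((u ++ u') −ᴸ (v ++ v')) ((u −ᴸ v) ++ (u' −ᴸ v')) (λ m → begin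
      coef ((u ++ u') −ᴸ (v ++ v')) m ≈⟨ coef-− (u ++ u') _ m ⟩
      coef (u ++ u') m + −1# * coef (v ++ v') m ≈⟨ +-cong (coef-++ u u' m) (*-congˡ (coef-++ v v' m)) ⟩
      (coef u m + coef u' m) + −1# * (coef v m + coef v' m) ≈⟨ −1-interchange _ _ _ _ ⟩
      (coef u m + −1# * coef v m) + (coef u' m + −1# * coef v' m) ≈⟨ sym (+-cong (coef-− u v m) (coef-− u' v' m)) ⟩
      coef (u −ᴸ v) m + coef (u' −ᴸ v') m ≈⟨ sym (coef-++ (u −ᴸ v) _ m) ⟩
      coef ((u −ᴸ v) ++ (u' −ᴸ v')) m ∎) (ideal-++ (u −ᴸ v) (u' −ᴸ v') h h'))

    ∼-scale : ∀ k {u v : Lin n} → u ∼ v → scale k u ∼ scale k v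
    ∼-scale k {u} {v} (mk∼ h) = mk∼ (ideal-resp (scale k u −ᴸ scale k v) (scale k (u −ᴸ v)) (λ m → begin
      coef (scale k u −ᴸ scale k v) m ≈⟨ coef-− (scale k u) _ m ⟩
      coef (scale k u) m + −1# * coef (scale k v) m ≈⟨ +-cong (coef-scale k u m) (*-congˡ (coef-scale k v m)) ⟩
      k * coef u m + −1# * (k * coef v m) ≈⟨ −1-scale k _ _ ⟩
      k * (coef u m + −1# * coef v m) ≈⟨ *-congˡ (sym (coef-− u v m)) ⟩
      k * coef (u −ᴸ v) m ≈⟨ sym (coef-scale k (u −ᴸ v) m) ⟩
      coef (scale k (u −ᴸ v)) m ∎) (ideal-scale k (u −ᴸ v) h))

    ∼-ctx : ∀ C {u v : Lin n} → u ∼ v → mapMon (plug C) u ∼ mapMon (plug C) v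
    ∼-ctx C {u} {v} (mk∼ h) = mk∼ (≡.subst InIdeal (≡.trans (map-++ _ u (scale −1# v)) (≡.cong (mapMon (plug C) u ++_) (mapMon-scale (plug C) −1# v))) (ideal-ctx C (u −ᴸ v) h))

    −1*−1≈1 : −1# * −1# ≈ 1#
    −1*−1≈1 = trans (-1*x≈-x −1#) (⁻¹-involutive 1#)

    coef-swap-middle : ∀ (k1 k2 k3 k4 k1' k2' k3' k4' : Carrier) (x1 x2 x3 x4 : Mag n) m → k1 ≈ k1' → k2 ≈ k3' → k3 ≈ k2' → k4 ≈ k4' →
           coef ((k1 , x1) ∷ (k2 , x2) ∷ (k3 , x3) ∷ (k4 , x4) ∷ []) m ≈ coef ((k1' , x1) ∷ (k2' , x3) ∷ (k3' , x2) ∷ (k4' , x4) ∷ []) m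
    coef-swap-middle k1 k2 k3 k4 k1' k2' k3' k4' x1 x2 x3 x4 m e1 e2 e3 e4 =
      coef-cons {u = (k2 , x2) ∷ (k3 , x3) ∷ (k4 , x4) ∷ []} {v = (k2' , x3) ∷ (k3' , x2) ∷ (k4' , x4) ∷ []} x1 m e1
        (trans (coef-swap (k2 , x2) (k3 , x3) ((k4 , x4) ∷ []) m)
          (coef-cons {u = (k2 , x2) ∷ (k4 , x4) ∷ []} {v = (k3' , x2) ∷ (k4' , x4) ∷ []} x3 m e3
            (coef-cons {u = (k4 , x4) ∷ []} {v = (k4' , x4) ∷ []} x2 m e2
              (coef-cons {u = []} {v = []} x4 m e4 refl))))

    preLie-∼ : ∀ (a b d : Mag n) → ((1# , (a · b) · d) ∷ []) ∼ ((1# , (a · d) · b) ∷ (1# , a · (b · d)) ∷ (−1# , a · (d · b)) ∷ [])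
    preLie-∼ a b d = mk∼ (ideal-resp difference (evalGens relation) reorder (relation , λ m → refl))
      where
      difference : Lin n
      difference = ((1# , (a · b) · d) ∷ []) −ᴸ ((1# , (a · d) · b) ∷ (1# , a · (b · d)) ∷ (−1# , a · (d · b)) ∷ [])
      relation : List (IdealGen n)
      relation = (1# , hole , a , b , d) ∷ []
      reorder : difference ≈ᴸ evalGens relation
      reorder m = coef-swap-middle 1# (−1# * 1#) (−1# * 1#) (−1# * −1#) (1# * 1#) (1# * −1#) (1# * −1#) (1# * 1#)
        ((a · b) · d) ((a · d) · b) (a · (b · d)) (a · (d · b)) m
        (sym (*-identityˡ 1#)) (*-comm _ _) (*-comm _ _) (trans −1*−1≈1 (sym (*-identityˡ 1#)))

module Spanning {c ℓ} (F : Field c ℓ) where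

  open Occurrences
  open DisjointTrees
  open PreLieIdeal F
  open import Data.Nat as ℕ using (ℕ; zero; suc; z≤n; s≤s)
  open import Data.Nat.Properties using (≤-trans; <⇒≤; <⇒≱; ≰⇒>; ⊓-glb; m⊓n≤m; m≤n⇒m⊓n≡m; m⊓n≡m⇒m≤n; n<1+n; m≤m+n; m≤n+m; ≤-<-trans; ≤-reflexive; <-cmp)
  open import Data.Fin as Fin using (Fin)
  open import Data.List using (List; []; _∷_; _++_; map)
  open import Data.List.Properties using (map-++)
  open import Data.List.Relation.Unary.All as All using (All; []; _∷_)
  import Data.List.Relation.Unary.All.Properties as AllP
  open import Data.List.Relation.Binary.Permutation.Propositional using (_↭_; ↭-refl; ↭-trans; ↭-sym)
  open import Data.List.Relation.Binary.Permutation.Propositional.Properties using (++-comm; ++-assoc; ++⁺ˡ; ++⁺ʳ; ++⁺)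
  open import Data.Product using (_×_; _,_; Σ; ∃; proj₂)
  open import Relation.Nullary using (yes; no)
  import Relation.Binary.PropositionalEquality as ≡
  open ≡ using (_≡_)
  open import Relation.Binary.Definitions using (tri<; tri≈; tri>)
  open import Data.Empty using (⊥-elim)
  open import Function using (_∘_)
  import Level

  open Field F
  open FreeAlgebra F
  open ThetaComb F

  module _ {n : ℕ} where

    PointedLyndonOn : List (Fin n) → BTree n → Set
    PointedLyndonOn X T = IsPointedLyndon T × (leaves T ↭ X)

    Expands : List (Fin n) → Lin n → Set (c Level.⊔ ℓ)
    Expands X u = Σ (List (Carrier × BTree n)) λ ts → All (PointedLyndonOn X ∘ proj₂) ts × (u ∼ ΘLin ts)

    Expansion : List (Fin n) → Mag n → Set (c Level.⊔ ℓ)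
    Expansion X m = Expands X ((1# , m) ∷ [])

    scaleT : Carrier → List (Carrier × BTree n) → List (Carrier × BTree n)
    scaleT k = map (λ { (a , T) → (k * a , T) })

    ΘLin-scaleT : ∀ k ts → ΘLin (scaleT k ts) ≡ scale k (ΘLin ts)
    ΘLin-scaleT k [] = ≡.refl
    ΘLin-scaleT k ((a , T) ∷ ts) = ≡.cong ((k * a , Θ T) ∷_) (ΘLin-scaleT k ts)

    All-scaleT : ∀ {p} {Q : BTree n → Set p} k ts → All (Q ∘ proj₂) ts → All (Q ∘ proj₂) (scaleT k ts)
    All-scaleT k [] [] = []
    All-scaleT k ((a , T) ∷ ts) (g ∷ gs) = g ∷ All-scaleT k ts gs

    expands-[] : ∀ {X} → Expands X []
    expands-[] = [] , [] , ∼-refl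

    expands-++ : ∀ {X} {u v : Lin n} → Expands X u → Expands X v → Expands X (u ++ v)
    expands-++ {u = u} {v} (ts , a , r) (ts' , a' , r') =
      ts ++ ts' , AllP.++⁺ a a' , ≡.subst ((u ++ v) ∼_) (≡.sym (map-++ _ ts ts')) (∼-++ r r')

    expands-scale : ∀ {X} k {u : Lin n} → Expands X u → Expands X (scale k u)
    expands-scale k {u} (ts , a , r) = scaleT k ts , All-scaleT k ts a , ≡.subst (scale k u ∼_) (≡.sym (ΘLin-scaleT k ts)) (∼-scale k r)

    expands-resp : ∀ {X} {u v : Lin n} → u ∼ v → Expands X v → Expands X u
    expands-resp h (ts , a , r) = ts , a , ∼-trans h r

    expands-↭ : ∀ {X Y} {u : Lin n} → X ↭ Y → Expands X u → Expands Y u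
    expands-↭ p (ts , a , r) = ts , All.map (λ { (pl , q) → pl , ↭-trans q p }) a , r

    expansion-Θ : ∀ {X} T → PointedLyndonOn X T → Expansion X (Θ T)
    expansion-Θ T g = ((1# , T) ∷ []) , g ∷ [] , ∼-refl

    expansion-scale : ∀ {X} k {m : Mag n} → Expansion X m → Expands X ((k , m) ∷ [])
    expansion-scale k {m} e = expands-resp (≈ᴸ→∼ (λ x → coef-cons {u = []} {v = []} m x (sym (*-identityʳ k)) refl)) (expands-scale k e)

    expands-plug : ∀ (C : Ctx n) {X Y} (ks : List (Carrier × BTree n)) → All (PointedLyndonOn X ∘ proj₂) ks →
                   (∀ K → PointedLyndonOn X K → Expansion Y (plug C (Θ K))) → Expands Y (mapMon (plug C) (ΘLin ks))
    expands-plug C [] [] g = expands-[]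
    expands-plug C ((k , K) ∷ ks) (gK ∷ gks) g = expands-++ (expansion-scale k (g K gK)) (expands-plug C ks gks g)

    expansion-plug : ∀ (C : Ctx n) {X Y} {m : Mag n} → Expansion X m →
                     (∀ K → PointedLyndonOn X K → Expansion Y (plug C (Θ K))) → Expansion Y (plug C m)
    expansion-plug C (ks , a , r) g = expands-resp (∼-ctx C r) (expands-plug C ks a g)

    expansion-preLie : ∀ {Y} (a b d : Mag n) → Expansion Y ((a · d) · b) → Expansion Y (a · (b · d)) → Expansion Y (a · (d · b)) →
                       Expansion Y ((a · b) · d)
    expansion-preLie a b d e₁ e₂ e₃ = expands-resp (preLie-∼ a b d) (expands-++ e₁ (expands-++ e₂ (expansion-scale −1# e₃)))

    PLLocal-zero : ∀ (l r : BTree n) → PLLocal Fin.zero l r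
    PLLocal-zero (leaf _) r = _
    PLLocal-zero (node _ _ _) r = z≤n , λ _ ()

    colour0-PointedLyndon : ∀ {l r : BTree n} → ν l ℕ.≤ ν r → IsPointedLyndon l → IsPointedLyndon r → IsPointedLyndon (node Fin.zero l r)
    colour0-PointedLyndon {l} {r} le pl pr = m≤n⇒m⊓n≡m le , PLLocal-zero l r , pl , pr

    ↭-regroupˡ : ∀ (l r b : List (Fin n)) → (l ++ b) ++ r ↭ (l ++ r) ++ b
    ↭-regroupˡ l r b = ↭-trans (++-assoc l b r) (↭-trans (++⁺ˡ l (++-comm b r)) (↭-sym (++-assoc l r b)))

    ↭-regroupʳ : ∀ (l r b : List (Fin n)) → l ++ (r ++ b) ↭ (l ++ r) ++ b
    ↭-regroupʳ l r b = ↭-sym (++-assoc l r b)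

    ProductExpansions : ℕ → Set (c Level.⊔ ℓ)
    ProductExpansions k = ∀ (B B' : BTree n) → IsPointedLyndon B → IsPointedLyndon B' → ν B ℕ.< ν B' → Disjoint B B' →
           belowᵀ B (ν B') ℕ.< k → Expansion (leaves B ++ leaves B') (Θ B · Θ B')

    expandProduct-colour0 : ∀ k (L R B' : BTree n) → ν L ℕ.≤ ν R → IsPointedLyndon L → IsPointedLyndon R → IsPointedLyndon B' →
      ν L ℕ.< ν B' → Disjoint (node Fin.zero L R) B' → belowᵀ (node Fin.zero L R) (ν B') ℕ.< suc k → ProductExpansions k →
      Expansion (leaves L ++ leaves B') (Θ L · Θ B') → Expansion ((leaves L ++ leaves R) ++ leaves B') ((Θ R · Θ L) · Θ B')
    expandProduct-colour0 k L R B' L≤R pL pR pB' L<B' d small rec LB' =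
      expansion-preLie (Θ R) (Θ L) (Θ B')
        (expansion-plug (hole ◁ Θ L) RB' graft-L)
        (expansion-plug (Θ R ▷ hole) LB' under-R)
        (expansion-Θ (node Fin.zero (node Fin.zero L B') R) (colour0-PointedLyndon (≡.subst (ℕ._≤ ν R) (≡.sym (m≤n⇒m⊓n≡m (<⇒≤ L<B'))) L≤R)
                        (colour0-PointedLyndon (<⇒≤ L<B') pL pB') pR ,
                      ↭-regroupˡ (leaves L) (leaves R) (leaves B')))
      where
      RB' : Expansion (leaves R ++ leaves B') (Θ R · Θ B')
      RB' with ν B' ℕ.≤? ν R
      ... | yes le = expands-↭ (++-comm (leaves B') (leaves R)) (expansion-Θ (node Fin.zero B' R) (colour0-PointedLyndon le pB' pR , ↭-refl))
      ... | no nle = rec R B' pR pB' (≰⇒> nle) (disjoint-right L R B' d) (+<suc⇒<ʳ (belowᵀ L (ν B')) (belowᵀ R (ν B')) k (belowᵀ-pos L (ν B') L<B') small)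
      graft-L : ∀ K → PointedLyndonOn (leaves R ++ leaves B') K → Expansion ((leaves L ++ leaves R) ++ leaves B') (Θ K · Θ L)
      graft-L K (pK , q) = expansion-Θ (node Fin.zero L K) (colour0-PointedLyndon L≤K pL pK , ↭-trans (++⁺ˡ (leaves L) q) (↭-regroupʳ (leaves L) (leaves R) (leaves B')))
        where
        L≤K : ν L ℕ.≤ ν K
        L≤K = ≡.subst (ν L ℕ.≤_) (≡.sym (ν-↭++ K R B' q)) (⊓-glb L≤R (<⇒≤ L<B'))
      under-R : ∀ K → PointedLyndonOn (leaves L ++ leaves B') K → Expansion ((leaves L ++ leaves R) ++ leaves B') (Θ R · Θ K)
      under-R K (pK , q) = expansion-Θ (node Fin.zero K R) (colour0-PointedLyndon K≤R pK pR , ↭-trans (++⁺ʳ (leaves R) q) (↭-regroupˡ (leaves L) (leaves R) (leaves B')))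
        where
        K≤R : ν K ℕ.≤ ν R
        K≤R = ≡.subst (ℕ._≤ ν R) (≡.sym (ν-↭++ K L B' q)) (≤-trans (m⊓n≤m _ _) L≤R)

    module Colour1 (k : ℕ) (L R B' : BTree n) (pL : IsPointedLyndon L) (pR : IsPointedLyndon R) (pB' : IsPointedLyndon B')
                   (L<R : ν L ℕ.< ν R) (R<B' : ν R ℕ.< ν B') (d : Disjoint (node 𝟙 L R) B')
                   (small : belowᵀ (node 𝟙 L R) (ν B') ℕ.< suc k) (rec : ProductExpansions k) where

      L<B' : ν L ℕ.< ν B'
      L<B' = Data.Nat.Properties.<-trans L<R R<B'

      small-L : belowᵀ L (ν B') ℕ.< k
      small-L = +<suc⇒<ˡ (belowᵀ L (ν B')) (belowᵀ R (ν B')) k (belowᵀ-pos R (ν B') R<B') small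

      small-R : belowᵀ R (ν B') ℕ.< k
      small-R = +<suc⇒<ʳ (belowᵀ L (ν B')) (belowᵀ R (ν B')) k (belowᵀ-pos L (ν B') L<B') small

      small-L-νR : belowᵀ L (ν R) ℕ.< k
      small-L-νR = ≤-<-trans (belowᵀ-mono L (ν R) (ν B') (<⇒≤ R<B')) small-L

      ν-RB' : ν R ℕ.⊓ ν B' ≡ ν R
      ν-RB' = m≤n⇒m⊓n≡m (<⇒≤ R<B')

      graft-R : ∀ K → PointedLyndonOn (leaves L ++ leaves B') K → Expansion ((leaves L ++ leaves R) ++ leaves B') (Θ K · Θ R)
      graft-R K (pK , q) = expands-↭ (↭-trans (++⁺ʳ (leaves R) q) (↭-regroupˡ (leaves L) (leaves R) (leaves B')))
          (rec K R pK pR (≡.subst (ℕ._< ν R) (≡.sym νK) L<R) (disjoint-regroupˡ L R B' d K q) small-K)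
        where
        νK : ν K ≡ ν L
        νK = ≡.trans (ν-↭++ K L B' q) (m≤n⇒m⊓n≡m (<⇒≤ L<B'))
        small-K : belowᵀ K (ν R) ℕ.< k
        small-K = ≡.subst (ℕ._< k) (≡.sym (≡.trans (countᵀ-↭++ _ K L B' q)
                    (≡.trans (≡.cong (belowᵀ L (ν R) ℕ.+_) (belowᵀ-zero B' (ν R) (<⇒≤ R<B'))) (Data.Nat.Properties.+-identityʳ _)))) small-L-νR

      L-under : ∀ K → PointedLyndonOn (leaves R ++ leaves B') K → Expansion ((leaves L ++ leaves R) ++ leaves B') (Θ L · Θ K)
      L-under K (pK , q) = expands-↭ (↭-trans (++⁺ˡ (leaves L) q) (↭-regroupʳ (leaves L) (leaves R) (leaves B')))
          (rec L K pL pK (≡.subst (ν L ℕ.<_) (≡.sym νK) L<R) (disjoint-regroupʳ L R B' d K q) (≡.subst (λ z → belowᵀ L z ℕ.< k) (≡.sym νK) small-L-νR))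
        where
        νK : ν K ≡ ν R
        νK = ≡.trans (ν-↭++ K R B' q) ν-RB'

      expansion : Expansion ((leaves L ++ leaves R) ++ leaves B') ((Θ L · Θ R) · Θ B')
      expansion =
        expansion-preLie (Θ L) (Θ R) (Θ B')
          (expansion-plug (hole ◁ Θ R) (rec L B' pL pB' L<B' (disjoint-left L R B' d) small-L) graft-R)
          (expansion-plug (Θ L ▷ hole) (rec R B' pR pB' R<B' (disjoint-right L R B' d) small-R) L-under)
          (expands-↭ (↭-regroupʳ (leaves L) (leaves R) (leaves B'))
             (rec L (node Fin.zero R B') pL (colour0-PointedLyndon (<⇒≤ R<B') pR pB')
                  (≡.subst (ν L ℕ.<_) (≡.sym ν-RB') L<R) (disjoint-assoc L R B' d)
                  (≡.subst (λ z → belowᵀ L z ℕ.< k) (≡.sym ν-RB') small-L-νR)))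

    expandProduct-colour1 : ∀ k (L R B' : BTree n) → IsPointedLyndon (node 𝟙 L R) → IsPointedLyndon B' →
      ν (node 𝟙 L R) ℕ.< ν B' → Disjoint (node 𝟙 L R) B' → belowᵀ (node 𝟙 L R) (ν B') ℕ.< suc k → ProductExpansions k →
      Expansion ((leaves L ++ leaves R) ++ leaves B') ((Θ L · Θ R) · Θ B')
    expandProduct-colour1 k L R B' pB@(νB , _ , pL , pR) pB' lt d small rec with ν B' ℕ.<? ν R
    ... | yes lyndon = expansion-Θ (node 𝟙 (node 𝟙 L R) B') ((m≤n⇒m⊓n≡m (<⇒≤ lt) , (s≤s z≤n , λ _ _ → lyndon) , pB , pB') , ↭-refl)
    ... | no ¬lyndon = Colour1.expansion k L R B' pL pR pB' L<R R<B' d small rec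
      where
      L<R : ν L ℕ.< ν R
      L<R with <-cmp (ν L) (ν R)
      ... | tri< x _ _ = x
      ... | tri≈ _ e _ = ⊥-elim (ν-disjoint-≢ L R (disjoint-children L R B' d) e)
      ... | tri> _ _ x = ⊥-elim (<⇒≱ x (m⊓n≡m⇒m≤n νB))
      R<B' : ν R ℕ.< ν B'
      R<B' with <-cmp (ν R) (ν B')
      ... | tri< x _ _ = x
      ... | tri≈ _ e _ = ⊥-elim (ν-disjoint-≢ R B' (disjoint-right L R B' d) e)
      ... | tri> _ _ x = ⊥-elim (¬lyndon x)

    expandProduct : ∀ (k : ℕ) → ProductExpansions k
    expandProduct zero B B' _ _ _ _ ()
    expandProduct (suc k) (leaf a) B' pB pB' lt d small = expansion-Θ (node 𝟙 (leaf a) B') ((m≤n⇒m⊓n≡m (<⇒≤ lt) , _ , _ , pB') , ↭-refl)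
    expandProduct (suc k) (node (Fin.suc (Fin.suc ())) L R) B' pB pB' lt d small
    expandProduct (suc k) (node Fin.zero L R) B' (νB , _ , pL , pR) pB' lt d small =
      expandProduct-colour0 k L R B' (m⊓n≡m⇒m≤n νB) pL pR pB' L<B' d small (expandProduct k)
        (expandProduct (suc k) L B' pL pB' L<B' (disjoint-left L R B' d) (≤-<-trans (m≤m+n _ _) small))
      where
      L<B' : ν L ℕ.< ν B'
      L<B' = ≡.subst (ℕ._< ν B') νB lt
    expandProduct (suc k) (node 𝟙 L R) B' pB pB' lt d small = expandProduct-colour1 k L R B' pB pB' lt d small (expandProduct k)

    expandΘ·Θ : ∀ B B' {X Y} → Disjoint B B' → PointedLyndonOn X B → PointedLyndonOn Y B' → Expansion (X ++ Y) (Θ B · Θ B')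
    expandΘ·Θ B B' dist (pB , qB) (pB' , qB') with <-cmp (ν B) (ν B')
    ... | tri< lt _ _ = expands-↭ (++⁺ qB qB') (expandProduct (suc (belowᵀ B (ν B'))) B B' pB pB' lt dist (n<1+n _))
    ... | tri≈ _ e _ = ⊥-elim (ν-disjoint-≢ B B' dist e)
    ... | tri> _ _ gt = expansion-Θ (node Fin.zero B' B) (colour0-PointedLyndon (<⇒≤ gt) pB' pB , ↭-trans (++-comm (leaves B') (leaves B)) (++⁺ qB qB'))

    occᵀ-magLeaves : ∀ a (B : BTree n) (x : Mag n) → leaves B ↭ magLeaves x → occᵀ a B ≡ occᴹ a x
    occᵀ-magLeaves a B x p = ≡.trans (countᵀ-leaves (a Fin.≟_) B) (≡.trans (count-↭ (a Fin.≟_) p) (≡.sym (occᴹ-magLeaves a x)))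

    expand : ∀ (m : Mag n) → (∀ a → occᴹ a m ℕ.≤ 1) → Expansion (magLeaves m) m
    expand (gen a) d = expansion-Θ (leaf a) (_ , ↭-refl)
    expand (x · y) d = expansion-plug (hole ◁ y) (expand x (λ a → ≤-trans (m≤m+n _ _) (d a))) times-y
      where
      times-y : ∀ B → PointedLyndonOn (magLeaves x) B → Expansion (magLeaves (x · y)) (Θ B · y)
      times-y B gB = expansion-plug (Θ B ▷ hole) (expand y (λ a → ≤-trans (m≤n+m _ _) (d a))) (λ B' gB' → expandΘ·Θ B B' (disjoint B' gB') gB gB')
        where
        disjoint : ∀ B' → PointedLyndonOn (magLeaves y) B' → Disjoint B B'
        disjoint B' gB' a = ≡.subst (ℕ._≤ 1) (≡.sym (≡.cong₂ ℕ._+_ (occᵀ-magLeaves a B x (proj₂ gB)) (occᵀ-magLeaves a B' y (proj₂ gB')))) (d a)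

    spanning : ∀ (m : Mag n) → Multilinear m → ∃ λ (ts : List (Carrier × BTree n)) →
           All (λ p → InTLyn n (proj₂ p)) ts × InIdeal (((1# , m) ∷ []) −ᴸ ΘLin ts)
    spanning m ml with expand m (λ a → ≤-reflexive (≡.trans (occᴹ-magLeaves a m) (≡.trans (count-↭ (a Fin.≟_) ml) (occ-allFin a))))
    ... | ts , gs , r = ts , All.map (λ { (pl , q) → pl , ↭-trans q ml }) gs , get r

module RootedTrees where

  open Occurrences
  open import Data.Nat as ℕ using (ℕ; zero; suc; _+_; _*_; _≤_; _<_; z≤n; s≤s)
  open import Data.Nat.Properties
  open import Data.Fin as Fin using (Fin)
  open import Data.List using (List; []; _∷_)
  open import Data.Sum using (inj₁; inj₂)
  open import Data.Product using (_×_; _,_; Σ; proj₁; proj₂)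
  open import Data.Unit using (⊤; tt)
  open import Relation.Nullary using (¬_; Dec; yes; no)
  import Relation.Binary.PropositionalEquality
  open import Relation.Binary.PropositionalEquality using (_≡_; _≢_; refl; sym; trans; cong; subst)
  open import Data.Empty using (⊥-elim)

  module _ {n : ℕ} where

    root : Mag n → Fin n
    root (gen a) = a
    root (x · y) = root x

    -- A map P : Fin n → Fin n is read as the parent map of a rooted tree on the labels. treeCoef P m is the
    -- coefficient of that tree in the image of m in the pre-Lie algebra of rooted trees, where x · y is the sum
    -- of the trees obtained by grafting the root of y onto a vertex of x.
    treeCoef : (Fin n → Fin n) → Mag n → ℕ
    treeCoef P (gen a) = 1
    treeCoef P (x · y) = treeCoef P x * treeCoef P y * occᴹ (P (root y)) x

    -- The leading tree of m grafts, in every product x · y, the root of y onto the root of x;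
    -- parent m and depth m describe it.
    parentStep : ∀ {p} {A : Set p} → Dec A → ℕ → Fin n → Fin n → Fin n → Fin n
    parentStep (yes _) _ a l r = a
    parentStep (no _) zero a l r = l
    parentStep (no _) (suc _) a l r = r

    parent : Mag n → Fin n → Fin n
    parent (gen a) u = a
    parent (x · y) u = parentStep (u Fin.≟ root y) (occᴹ u y) (root x) (parent x u) (parent y u)

    depthStep : ℕ → ℕ → ℕ → ℕ
    depthStep zero l r = l
    depthStep (suc _) l r = suc r

    depth : Mag n → Fin n → ℕ
    depth (gen a) u = 0
    depth (x · y) u = depthStep (occᴹ u y) (depth x u) (depth y u)

    Realises : (Fin n → Fin n) → Mag n → Set
    Realises P (gen a) = ⊤
    Realises P (x · y) = (P (root y) ≡ root x) × Realises P x × Realises P y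

    realises? : ∀ P m → Dec (Realises P m)
    realises? P (gen a) = yes tt
    realises? P (x · y) with P (root y) Fin.≟ root x | realises? P x | realises? P y
    ... | yes e | yes mx | yes my = yes (e , mx , my)
    ... | no ne | _ | _ = no λ z → ne (proj₁ z)
    ... | yes _ | no nx | _ = no λ z → nx (proj₁ (proj₂ z))
    ... | yes _ | yes _ | no ny = no λ z → ny (proj₂ (proj₂ z))

    record AtMostOnce (m : Mag n) : Set where
      constructor mkAtMostOnce
      field atMostOnce : ∀ a → occᴹ a m ≤ 1
    open AtMostOnce public

    ParentsAgree : (Fin n → Fin n) → Mag n → Set
    ParentsAgree P m = ∀ w → w ∈ᴹ m → w ≢ root m → P w ≡ parent m w

    root-occurs : ∀ m → root m ∈ᴹ m
    root-occurs (gen a) = ≤-reflexive (sym (indicator-yes (a Fin.≟ a) refl))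
    root-occurs (x · y) = ≤-trans (root-occurs x) (m≤m+n _ _)

    atMostOnce-left : ∀ {x y : Mag n} → AtMostOnce (x · y) → AtMostOnce x
    atMostOnce-left d = mkAtMostOnce λ a → ≤-trans (m≤m+n _ _) (atMostOnce d a)

    atMostOnce-right : ∀ {x y : Mag n} → AtMostOnce (x · y) → AtMostOnce y
    atMostOnce-right d = mkAtMostOnce λ a → ≤-trans (m≤n+m _ _) (atMostOnce d a)

    absent-rightˡ : ∀ {x y : Mag n} {a : Fin n} → AtMostOnce (x · y) → a ∈ᴹ x → occᴹ a y ≡ 0
    absent-rightˡ {x} {y} {a} d h = +≤1⇒absentʳ (occᴹ a x) (occᴹ a y) (atMostOnce d a) h

    absent-leftʳ : ∀ {x y : Mag n} {a : Fin n} → AtMostOnce (x · y) → a ∈ᴹ y → occᴹ a x ≡ 0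
    absent-leftʳ {x} {y} {a} d h = +≤1⇒absentʳ (occᴹ a y) (occᴹ a x) (subst (_≤ 1) (+-comm (occᴹ a x) (occᴹ a y)) (atMostOnce d a)) h

    present-absent-≢ : ∀ {a b : Fin n} {m} → a ∈ᴹ m → occᴹ b m ≡ 0 → a ≢ b
    present-absent-≢ {a} {m = m} h e refl = 1≰0 (subst (1 ≤_) e h)

    parent-graft : ∀ x y → parent (x · y) (root y) ≡ root x
    parent-graft x y with root y Fin.≟ root y
    ... | yes _ = refl
    ... | no ne = ⊥-elim (ne refl)

    parent-right : ∀ x y u → u ≢ root y → u ∈ᴹ y → parent (x · y) u ≡ parent y u
    parent-right x y u ne h with u Fin.≟ root y
    ... | yes e = ⊥-elim (ne e)
    ... | no _ with occᴹ u y
    ...   | suc _ = refl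
    parent-right x y u ne () | no _ | zero

    parent-left : ∀ x y u → u ≢ root y → occᴹ u y ≡ 0 → parent (x · y) u ≡ parent x u
    parent-left x y u ne e with u Fin.≟ root y
    ... | yes e' = ⊥-elim (ne e')
    ... | no _ rewrite e = refl

    depth-right : ∀ x y u → u ∈ᴹ y → depth (x · y) u ≡ suc (depth y u)
    depth-right x y u h with occᴹ u y
    ... | suc _ = refl
    depth-right x y u () | zero

    depth-left : ∀ x y u → occᴹ u y ≡ 0 → depth (x · y) u ≡ depth x u
    depth-left x y u e rewrite e = refl

    root-left-absent : ∀ {x y : Mag n} → AtMostOnce (x · y) → occᴹ (root x) y ≡ 0
    root-left-absent {x} d = absent-rightˡ d (root-occurs x)

    root-right≢root-left : ∀ {x y : Mag n} → AtMostOnce (x · y) → root y ≢ root x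
    root-right≢root-left {x} {y} d = present-absent-≢ {m = y} (root-occurs y) (root-left-absent d)

    parent-root : ∀ m → AtMostOnce m → parent m (root m) ≡ root m
    parent-root (gen a) d = refl
    parent-root (x · y) d = trans (parent-left x y (root x) (λ e → root-right≢root-left d (sym e)) (root-left-absent d)) (parent-root x (atMostOnce-left d))

    data Position (x y : Mag n) (u : Fin n) : Set where
      atGraft : u ≡ root y → Position x y u
      inRight : u ≢ root y → u ∈ᴹ y → Position x y u
      inLeft : u ≢ root y → occᴹ u y ≡ 0 → u ∈ᴹ x → Position x y u

    position : ∀ x y u → u ∈ᴹ (x · y) → Position x y u
    position x y u h with u Fin.≟ root y
    ... | yes e = atGraft e
    ... | no ne with occᴹ u y in eq
    ...   | zero = inLeft ne eq (subst (1 ≤_) (+-identityʳ _) h)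
    ...   | suc k = inRight ne (subst (1 ≤_) (sym eq) (s≤s z≤n))

    parent-occurs : ∀ m → AtMostOnce m → ∀ u → u ∈ᴹ m → parent m u ∈ᴹ m
    parent-occurs (gen a) d u h = root-occurs (gen a)
    parent-occurs (x · y) d u h with position x y u h
    ... | atGraft refl = subst (λ z → z ∈ᴹ (x · y)) (sym (parent-graft x y)) (root-occurs (x · y))
    ... | inRight ne hy = subst (λ z → z ∈ᴹ (x · y)) (sym (parent-right x y u ne hy)) (≤-trans (parent-occurs y (atMostOnce-right d) u hy) (m≤n+m _ _))
    ... | inLeft ne e hx = subst (λ z → z ∈ᴹ (x · y)) (sym (parent-left x y u ne e)) (≤-trans (parent-occurs x (atMostOnce-left d) u hx) (m≤m+n _ _))

    parent-≢ : ∀ m → AtMostOnce m → ∀ u → u ∈ᴹ m → u ≢ root m → parent m u ≢ u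
    parent-≢ (gen a) d u h ne e = ne (sym e)
    parent-≢ (x · y) d u h ne with position x y u h
    ... | atGraft refl = λ e → root-right≢root-left d (sym (trans (sym (parent-graft x y)) e))
    ... | inRight ne' hy = λ e → parent-≢ y (atMostOnce-right d) u hy ne' (trans (sym (parent-right x y u ne' hy)) e)
    ... | inLeft ne' ez hx = λ e → parent-≢ x (atMostOnce-left d) u hx ne (trans (sym (parent-left x y u ne' ez)) e)

    depth-root : ∀ m → AtMostOnce m → depth m (root m) ≡ 0
    depth-root (gen a) d = refl
    depth-root (x · y) d = trans (depth-left x y (root x) (root-left-absent d)) (depth-root x (atMostOnce-left d))

    depth-pos : ∀ m → AtMostOnce m → ∀ v → v ∈ᴹ m → v ≢ root m → 1 ≤ depth m v
    depth-pos (gen a) d v h ne = ⊥-elim (ne (indicator-pos (_ Fin.≟ _) h))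
    depth-pos (x · y) d v h ne with position x y v h
    ... | atGraft refl = subst (1 ≤_) (sym (depth-right x y (root y) (root-occurs y))) (s≤s z≤n)
    ... | inRight _ hy = subst (1 ≤_) (sym (depth-right x y v hy)) (s≤s z≤n)
    ... | inLeft _ e hx = subst (1 ≤_) (sym (depth-left x y v e)) (depth-pos x (atMostOnce-left d) v hx ne)

    depth-parent : ∀ m → AtMostOnce m → ∀ w → w ∈ᴹ m → w ≢ root m → suc (depth m (parent m w)) ≡ depth m w
    depth-parent (gen a) d w h ne = ⊥-elim (ne (indicator-pos (_ Fin.≟ _) h))
    depth-parent (x · y) d w h ne with position x y w h
    ... | atGraft refl = begin
        suc (depth (x · y) (parent (x · y) (root y))) ≡⟨ cong (λ z → suc (depth (x · y) z)) (parent-graft x y) ⟩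
        suc (depth (x · y) (root x)) ≡⟨ cong suc (trans (depth-left x y (root x) (root-left-absent d)) (depth-root x (atMostOnce-left d))) ⟩
        1 ≡⟨ cong suc (sym (depth-root y (atMostOnce-right d))) ⟩
        suc (depth y (root y)) ≡⟨ sym (depth-right x y (root y) (root-occurs y)) ⟩
        depth (x · y) (root y) ∎
      where open Relation.Binary.PropositionalEquality.≡-Reasoning
    ... | inRight ne' hy = begin
        suc (depth (x · y) (parent (x · y) w)) ≡⟨ cong (λ z → suc (depth (x · y) z)) (parent-right x y w ne' hy) ⟩
        suc (depth (x · y) (parent y w)) ≡⟨ cong suc (depth-right x y (parent y w) (parent-occurs y (atMostOnce-right d) w hy)) ⟩
        suc (suc (depth y (parent y w))) ≡⟨ cong suc (depth-parent y (atMostOnce-right d) w hy ne') ⟩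
        suc (depth y w) ≡⟨ sym (depth-right x y w hy) ⟩
        depth (x · y) w ∎
      where open Relation.Binary.PropositionalEquality.≡-Reasoning
    ... | inLeft ne' e hx = begin
        suc (depth (x · y) (parent (x · y) w)) ≡⟨ cong (λ z → suc (depth (x · y) z)) (parent-left x y w ne' e) ⟩
        suc (depth (x · y) (parent x w)) ≡⟨ cong suc (depth-left x y (parent x w) (absent-rightˡ d (parent-occurs x (atMostOnce-left d) w hx))) ⟩
        suc (depth x (parent x w)) ≡⟨ depth-parent x (atMostOnce-left d) w hx ne ⟩
        depth x w ≡⟨ sym (depth-left x y w e) ⟩
        depth (x · y) w ∎
      where open Relation.Binary.PropositionalEquality.≡-Reasoning

    *≢0⇒≢0 : ∀ a b → a * b ≢ 0 → (a ≢ 0) × (b ≢ 0)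
    *≢0⇒≢0 zero b h = ⊥-elim (h refl)
    *≢0⇒≢0 (suc a) zero h = ⊥-elim (h (*-zeroʳ (suc a)))
    *≢0⇒≢0 (suc a) (suc b) h = (λ ()) , (λ ())

    treeCoef-nonzero : ∀ P x y → treeCoef P (x · y) ≢ 0 → (treeCoef P x ≢ 0) × (treeCoef P y ≢ 0) × (P (root y) ∈ᴹ x)
    treeCoef-nonzero P x y h with *≢0⇒≢0 (treeCoef P x * treeCoef P y) (occᴹ (P (root y)) x) h
    ... | h1 , h2 with *≢0⇒≢0 (treeCoef P x) (treeCoef P y) h1
    ... | h3 , h4 = h3 , h4 , n≢0⇒n>0 h2

    -- δ is the depth function of the rooted tree P. If treeCoef P m ≠ 0, then P arises from the leading tree of m
    -- by regrafting subtrees onto deeper vertices, so depths can only grow, and strictly unless m realises P.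
    module DepthBound (P : Fin n → Fin n) (δ : Fin n → ℕ) (r₀ : Fin n) (P-root : P r₀ ≡ r₀)
               (δ-parent : ∀ w → w ≢ r₀ → suc (δ (P w)) ≡ δ w) where

      graft-δ : ∀ x y → AtMostOnce (x · y) → P (root y) ∈ᴹ x → suc (δ (P (root y))) ≡ δ (root y)
      graft-δ x y d hv = δ-parent (root y) λ e → present-absent-≢ {m = x} hv (absent-leftʳ {x} {y} d (root-occurs y)) (trans (cong P e) (trans P-root (sym e)))

      depth-graft≤ : ∀ x y → AtMostOnce (x · y) → P (root y) ∈ᴹ x →
                     depth x (P (root y)) + δ (root x) ≤ δ (P (root y)) →
                     ∀ u → u ∈ᴹ y → depth (x · y) u + δ (root x) ≤ depth y u + δ (root y)
      depth-graft≤ x y d hv hx u hy = begin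
        depth (x · y) u + δ (root x) ≡⟨ cong (_+ δ (root x)) (depth-right x y u hy) ⟩
        suc (depth y u) + δ (root x) ≤⟨ +-monoʳ-≤ (suc (depth y u)) (≤-trans (m≤n+m _ _) hx) ⟩
        suc (depth y u) + δ (P (root y)) ≡⟨ sym (+-suc (depth y u) _) ⟩
        depth y u + suc (δ (P (root y))) ≡⟨ cong (depth y u +_) (graft-δ x y d hv) ⟩
        depth y u + δ (root y) ∎
        where open ≤-Reasoning

      depth+≤ : ∀ m → AtMostOnce m → treeCoef P m ≢ 0 → ∀ u → u ∈ᴹ m → depth m u + δ (root m) ≤ δ u
      depth+≤ (gen a) d nz u h rewrite indicator-pos (u Fin.≟ a) h = ≤-refl
      depth+≤ (x · y) d nz u h with treeCoef-nonzero P x y nz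
      ... | nx , ny , hv with position x y u h
      ...   | inLeft ne e hx = subst (λ z → z + δ (root x) ≤ δ u) (sym (depth-left x y u e)) (depth+≤ x (atMostOnce-left d) nx u hx)
      ...   | atGraft refl = ≤-trans (depth-graft≤ x y d hv (depth+≤ x (atMostOnce-left d) nx _ hv) u (root-occurs y)) (depth+≤ y (atMostOnce-right d) ny u (root-occurs y))
      ...   | inRight _ hy = ≤-trans (depth-graft≤ x y d hv (depth+≤ x (atMostOnce-left d) nx _ hv) u hy) (depth+≤ y (atMostOnce-right d) ny u hy)

      depth+< : ∀ m → AtMostOnce m → treeCoef P m ≢ 0 → ¬ Realises P m → Σ (Fin n) λ u → (u ∈ᴹ m) × (depth m u + δ (root m) < δ u)
      depth+< (gen a) d nz nm = ⊥-elim (nm tt)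
      depth+< (x · y) d nz nm with treeCoef-nonzero P x y nz
      ... | nx , ny , hv with P (root y) Fin.≟ root x
      ...   | no ne = root y , ≤-trans (root-occurs y) (m≤n+m _ _) , (begin-strict
          depth (x · y) (root y) + δ (root x) ≡⟨ cong (_+ δ (root x)) (trans (depth-right x y (root y) (root-occurs y)) (cong suc (depth-root y (atMostOnce-right d)))) ⟩
          suc (δ (root x)) ≤⟨ +-monoˡ-≤ (δ (root x)) (depth-pos x (atMostOnce-left d) (P (root y)) hv ne) ⟩
          depth x (P (root y)) + δ (root x) ≤⟨ depth+≤ x (atMostOnce-left d) nx (P (root y)) hv ⟩
          δ (P (root y)) <⟨ n<1+n _ ⟩
          suc (δ (P (root y))) ≡⟨ graft-δ x y d hv ⟩
          δ (root y) ∎)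
        where open ≤-Reasoning
      ...   | yes e with realises? P x
      ...     | no nmx with depth+< x (atMostOnce-left d) nx nmx
      ...       | u , hu , lt = u , ≤-trans hu (m≤m+n _ _) , subst (λ z → z + δ (root x) < δ u) (sym (depth-left x y u (absent-rightˡ d hu))) lt
      depth+< (x · y) d nz nm | nx , ny , hv | yes e | yes mx with realises? P y
      ... | yes my = ⊥-elim (nm (e , mx , my))
      ... | no nmy with depth+< y (atMostOnce-right d) ny nmy
      ...   | u , hu , lt = u , ≤-trans hu (m≤n+m _ _) ,
              ≤-<-trans (depth-graft≤ x y d hv (depth+≤ x (atMostOnce-left d) nx _ hv) u hu) lt

    parentsAgree-left : ∀ {P} {x y : Mag n} → AtMostOnce (x · y) → ParentsAgree P (x · y) → ParentsAgree P x
    parentsAgree-left {P} {x} {y} d ag w hw ne = trans (ag w (≤-trans hw (m≤m+n _ _)) ne)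
      (parent-left x y w (present-absent-≢ {m = x} hw (absent-leftʳ {x} {y} d (root-occurs y))) (absent-rightˡ d hw))

    parentsAgree-right : ∀ {P} {x y : Mag n} → AtMostOnce (x · y) → ParentsAgree P (x · y) → ParentsAgree P y
    parentsAgree-right {P} {x} {y} d ag w hw ne = trans (ag w (≤-trans hw (m≤n+m _ _)) (present-absent-≢ {m = y} hw (root-left-absent d))) (parent-right x y w ne hw)

    parentsAgree-graft : ∀ {P} {x y : Mag n} → AtMostOnce (x · y) → ParentsAgree P (x · y) → P (root y) ≡ root x
    parentsAgree-graft {P} {x} {y} d ag = trans (ag (root y) (≤-trans (root-occurs y) (m≤n+m _ _)) (root-right≢root-left d)) (parent-graft x y)

    realises⇒parentsAgree : ∀ {P} m → AtMostOnce m → Realises P m → ParentsAgree P m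
    realises⇒parentsAgree (gen a) d _ w hw ne = ⊥-elim (ne (indicator-pos (_ Fin.≟ _) hw))
    realises⇒parentsAgree {P} (x · y) d (e , mx , my) w hw ne with position x y w hw
    ... | atGraft refl = trans e (sym (parent-graft x y))
    ... | inRight ne' hy = trans (realises⇒parentsAgree y (atMostOnce-right d) my w hy ne') (sym (parent-right x y w ne' hy))
    ... | inLeft ne' ez hx = trans (realises⇒parentsAgree x (atMostOnce-left d) mx w hx ne) (sym (parent-left x y w ne' ez))

    occ-root≡1 : ∀ m → AtMostOnce m → occᴹ (root m) m ≡ 1
    occ-root≡1 m d = ≤-antisym (atMostOnce d (root m)) (root-occurs m)

    parentsAgree⇒treeCoef≡1 : ∀ {P} m → AtMostOnce m → ParentsAgree P m → treeCoef P m ≡ 1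
    parentsAgree⇒treeCoef≡1 (gen a) d ag = refl
    parentsAgree⇒treeCoef≡1 {P} (x · y) d ag rewrite parentsAgree⇒treeCoef≡1 x (atMostOnce-left d) (parentsAgree-left d ag) | parentsAgree⇒treeCoef≡1 y (atMostOnce-right d) (parentsAgree-right d ag)
                                     | parentsAgree-graft {P} {x} {y} d ag = trans (+-identityʳ _) (occ-root≡1 x (atMostOnce-left d))

    parent-occurs-agree : ∀ {P} m → AtMostOnce m → ParentsAgree P m → ∀ w → w ∈ᴹ m → w ≢ root m → P w ∈ᴹ m
    parent-occurs-agree m d ag w hw ne = subst (λ z → z ∈ᴹ m) (sym (ag w hw ne)) (parent-occurs m d w hw)

    data Chain (P : Fin n → Fin n) (m : Mag n) (t : Fin n) : Fin n → Set where
      chain-end : Chain P m t t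
      chain-step : ∀ {w} → w ∈ᴹ m → w ≢ t → Chain P m t (P w) → Chain P m t w

    chainToRoot : ∀ {P} m → AtMostOnce m → ParentsAgree P m → ∀ w → w ∈ᴹ m → Chain P m (root m) w
    chainToRoot {P} m d ag w hw = aux (suc (depth m w)) w ≤-refl hw
      where
      aux : ∀ k w → depth m w < k → w ∈ᴹ m → Chain P m (root m) w
      aux zero w () hw
      aux (suc k) w lt hw with w Fin.≟ root m
      ... | yes refl = chain-end
      ... | no ne = chain-step hw ne (subst (Chain P m (root m)) (sym (ag w hw ne))
                      (aux k (parent m w) (≤-pred (subst (_≤ suc k) (sym (cong suc (depth-parent m d w hw ne))) lt)) (parent-occurs m d w hw)))

    chain-occurs : ∀ {P m t w} → t ∈ᴹ m → Chain P m t w → w ∈ᴹ m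
    chain-occurs ht chain-end = ht
    chain-occurs ht (chain-step h _ _) = h

    chain-transfer : ∀ {P A B t w} → Chain P A t w → w ∈ᴹ B →
         (∀ v → v ∈ᴹ A → v ∈ᴹ B → v ≢ t → P v ∈ᴹ A → P v ∈ᴹ B) → t ∈ᴹ A → t ∈ᴹ B
    chain-transfer chain-end hw hyp ht = hw
    chain-transfer {P} {A} {B} (chain-step {w} hA ne r) hw hyp ht = chain-transfer {P} {A} {B} r (hyp w hA hw ne (chain-occurs ht r)) hyp ht

    occ-moves-left : ∀ {a} (x y x' y' : Mag n) → (occᴹ a x + occᴹ a y ≡ occᴹ a x' + occᴹ a y') → a ∈ᴹ y → occᴹ a y' ≡ 0 → a ∈ᴹ x'
    occ-moves-left {a} x y x' y' e h z = subst (1 ≤_) (trans e (trans (cong (occᴹ a x' +_) z) (+-identityʳ _))) (≤-trans h (m≤n+m _ _))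

    module SameParents {P : Fin n → Fin n} (x y x' y' : Mag n)
             (d : AtMostOnce (x · y)) (d' : AtMostOnce (x' · y'))
             (ag : ParentsAgree P (x · y)) (ag' : ParentsAgree P (x' · y'))
             (root-x : root x ≡ root x') where

      -- The parent chain from z to root y stays inside y'; were root y not the root of y',
      -- its parent root x' would then lie in y'.
      rightRoot-≡ : ∀ z → z ∈ᴹ y → z ∈ᴹ y' → root y ≡ root y'
      rightRoot-≡ z hz hz' with root y Fin.≟ root y'
      ... | yes e = e
      ... | no ne = ⊥-elim (1≰0 (subst (1 ≤_) (absent-rightˡ d' (root-occurs x'))
              (subst (_∈ᴹ y') (trans (parentsAgree-graft d ag) root-x)
                (parent-occurs-agree y' (atMostOnce-right d') (parentsAgree-right d' ag') (root y) root-y∈y' ne))))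
        where
        closed : ∀ v → v ∈ᴹ y → v ∈ᴹ y' → v ≢ root y → P v ∈ᴹ y → P v ∈ᴹ y'
        closed v vy vy' _ pvy with v Fin.≟ root y'
        ... | yes refl = ⊥-elim (1≰0 (subst (1 ≤_) (absent-rightˡ d (root-occurs x))
                           (subst (_∈ᴹ y) (trans (parentsAgree-graft d' ag') (sym root-x)) pvy)))
        ... | no ne' = parent-occurs-agree y' (atMostOnce-right d') (parentsAgree-right d' ag') v vy' ne'
        root-y∈y' : root y ∈ᴹ y'
        root-y∈y' = chain-transfer {P = P} {A = y} {B = y'} (chainToRoot y (atMostOnce-right d) (parentsAgree-right d ag) z hz) hz' closed (root-occurs y)

      rightFactor-moves : (∀ a → occᴹ a x + occᴹ a y ≡ occᴹ a x' + occᴹ a y') → root y ≢ root y' →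
                          ∀ z → z ∈ᴹ y → z ∈ᴹ x' × z ≢ root x'
      rightFactor-moves same ne z z∈y = occ-moves-left x y x' y' (same z) z∈y z∉y' ,
                                        λ e → present-absent-≢ {m = y} z∈y (root-left-absent d) (trans e (sym root-x))
        where
        z∉y' : occᴹ z y' ≡ 0
        z∉y' with ≡0⊎1≤ (occᴹ z y')
        ... | inj₁ e = e
        ... | inj₂ h = ⊥-elim (ne (rightRoot-≡ z z∈y h))

      module _ (root-y : root y ≡ root y') (same : ∀ a → occᴹ a x + occᴹ a y ≡ occᴹ a x' + occᴹ a y') where

        rightFactor-⊆ : ∀ w → w ∈ᴹ y → w ∈ᴹ y'
        rightFactor-⊆ w hw with ≡0⊎1≤ (occᴹ w y')
        ... | inj₂ h = h
        ... | inj₁ z = ⊥-elim (1≰0 (subst (1 ≤_) (absent-leftʳ {x = x'} {y = y'} d' (root-occurs y')) (subst (_∈ᴹ x') root-y root-y∈x')))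
          where
          closed : ∀ v → v ∈ᴹ y → v ∈ᴹ x' → v ≢ root y → P v ∈ᴹ y → P v ∈ᴹ x'
          closed v vy vx' _ _ = parent-occurs-agree x' (atMostOnce-left d') (parentsAgree-left d' ag') v vx'
                                  (λ e → present-absent-≢ {m = y} vy (root-left-absent d) (trans e (sym root-x)))
          root-y∈x' : root y ∈ᴹ x'
          root-y∈x' = chain-transfer {P = P} {A = y} {B = x'} (chainToRoot y (atMostOnce-right d) (parentsAgree-right d ag) w hw)
                                     (occ-moves-left x y x' y' (same w) hw z) closed (root-occurs y)

    factors-same-occurrences : ∀ {P} (x y x' y' : Mag n) (d : AtMostOnce (x · y)) (d' : AtMostOnce (x' · y')) →
      ParentsAgree P (x · y) → ParentsAgree P (x' · y') → root x ≡ root x' → root y ≡ root y' →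
      (∀ a → occᴹ a x + occᴹ a y ≡ occᴹ a x' + occᴹ a y') →
      ∀ a → (occᴹ a x ≡ occᴹ a x') × (occᴹ a y ≡ occᴹ a y')
    factors-same-occurrences x y x' y' d d' ag ag' rx ry same a = +-cancelʳ-≡ (occᴹ a y) _ _ (trans (same a) (cong (occᴹ a x' +_) (sym eq-y))) , eq-y
      where
      eq-y : occᴹ a y ≡ occᴹ a y'
      eq-y = ≤1-≡ (atMostOnce (atMostOnce-right d) a) (atMostOnce (atMostOnce-right d') a)
                  (SameParents.rightFactor-⊆ x y x' y' d d' ag ag' rx ry same a)
                  (SameParents.rightFactor-⊆ x' y' x y d' d ag' ag (sym rx) (sym ry) (λ b → sym (same b)) a)

    sumOver : (Fin n → ℕ) → List (Fin n) → ℕ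
    sumOver f [] = 0
    sumOver f (x ∷ xs) = f x + sumOver f xs

    sumOver-mono : ∀ f g xs → (∀ u → f u ≤ g u) → sumOver f xs ≤ sumOver g xs
    sumOver-mono f g [] h = z≤n
    sumOver-mono f g (x ∷ xs) h = +-mono-≤ (h x) (sumOver-mono f g xs h)

    sumOver-strict : ∀ f g xs u → (∀ u → f u ≤ g u) → 1 ≤ occ u xs → f u < g u → sumOver f xs < sumOver g xs
    sumOver-strict f g [] u h () lt
    sumOver-strict f g (x ∷ xs) u h hu lt with u Fin.≟ x
    ... | yes refl = +-mono-<-≤ lt (sumOver-mono f g xs h)
    ... | no _ = +-mono-≤-< (h x) (sumOver-strict f g xs u h hu lt)

module TreeCoefficientPreLie where

  open Occurrences
  open RootedTrees
  open import Data.Nat as ℕ using (ℕ; _+_; _*_)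
  open import Data.Nat.Properties
  open import Data.Fin as Fin using (Fin)
  import Relation.Binary.PropositionalEquality
  open import Relation.Binary.PropositionalEquality using (_≡_; refl; sym; trans; cong; cong₂)
  open import Data.Nat.Solver using (module +-*-Solver)
  open +-*-Solver

  module _ {n : ℕ} where

    occᶜ : Ctx n → Fin n → ℕ
    occᶜ hole q = 0
    occᶜ (C ◁ m) q = occᶜ C q + occᴹ q m
    occᶜ (m ▷ C) q = occᴹ q m + occᶜ C q

    rootᶜ : Ctx n → Fin n → Fin n
    rootᶜ hole l = l
    rootᶜ (C ◁ m) l = rootᶜ C l
    rootᶜ (m ▷ C) l = root m

    occᴹ-plug : ∀ C x q → occᴹ q (plug C x) ≡ occᶜ C q + occᴹ q x
    occᴹ-plug hole x q = refl
    occᴹ-plug (C ◁ m) x q = trans (cong (_+ occᴹ q m) (occᴹ-plug C x q)) (trans (+-assoc (occᶜ C q) _ _) (trans (cong (occᶜ C q +_) (+-comm (occᴹ q x) (occᴹ q m))) (sym (+-assoc (occᶜ C q) _ _))))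
    occᴹ-plug (m ▷ C) x q = trans (cong (occᴹ q m +_) (occᴹ-plug C x q)) (sym (+-assoc (occᴹ q m) _ _))

    root-plug : ∀ C x → root (plug C x) ≡ rootᶜ C (root x)
    root-plug hole x = refl
    root-plug (C ◁ m) x = root-plug C x
    root-plug (m ▷ C) x = refl

  module _ {n : ℕ} (P : Fin n → Fin n) where

    ctxCoef : Ctx n → (Fin n → ℕ) → Fin n → ℕ
    ctxCoef hole f l = 1
    ctxCoef (C ◁ m) f l = ctxCoef C f l * treeCoef P m * (occᶜ C (P (root m)) + f (P (root m)))
    ctxCoef (m ▷ C) f l = treeCoef P m * ctxCoef C f l * occᴹ (P (rootᶜ C l)) m

    treeCoef-plug : ∀ C x → treeCoef P (plug C x) ≡ ctxCoef C (λ q → occᴹ q x) (root x) * treeCoef P x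
    treeCoef-plug hole x = sym (+-identityʳ _)
    treeCoef-plug (C ◁ m) x = begin
      treeCoef P (plug C x) * treeCoef P m * occᴹ (P (root m)) (plug C x) ≡⟨ cong₂ (λ u v → u * treeCoef P m * v) (treeCoef-plug C x) (occᴹ-plug C x (P (root m))) ⟩
      ctxCoef C f (root x) * treeCoef P x * treeCoef P m * (occᶜ C (P (root m)) + f (P (root m))) ≡⟨ solve 4 (λ a b c d → a :* b :* c :* d := a :* c :* d :* b) refl (ctxCoef C f (root x)) (treeCoef P x) (treeCoef P m) (occᶜ C (P (root m)) + f (P (root m))) ⟩
      ctxCoef C f (root x) * treeCoef P m * (occᶜ C (P (root m)) + f (P (root m))) * treeCoef P x ∎
      where
      open Relation.Binary.PropositionalEquality.≡-Reasoning
      f : Fin n → ℕ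
      f q = occᴹ q x
    treeCoef-plug (m ▷ C) x = begin
      treeCoef P m * treeCoef P (plug C x) * occᴹ (P (root (plug C x))) m ≡⟨ cong₂ (λ u v → treeCoef P m * u * occᴹ (P v) m) (treeCoef-plug C x) (root-plug C x) ⟩
      treeCoef P m * (ctxCoef C f (root x) * treeCoef P x) * occᴹ (P (rootᶜ C (root x))) m ≡⟨ solve 4 (λ a b c d → a :* (b :* c) :* d := a :* b :* d :* c) refl (treeCoef P m) (ctxCoef C f (root x)) (treeCoef P x) (occᴹ (P (rootᶜ C (root x))) m) ⟩
      treeCoef P m * ctxCoef C f (root x) * occᴹ (P (rootᶜ C (root x))) m * treeCoef P x ∎
      where
      open Relation.Binary.PropositionalEquality.≡-Reasoning
      f : Fin n → ℕ
      f q = occᴹ q x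

    ctxCoef-cong : ∀ C {f g : Fin n → ℕ} l → (∀ q → f q ≡ g q) → ctxCoef C f l ≡ ctxCoef C g l
    ctxCoef-cong hole l e = refl
    ctxCoef-cong (C ◁ m) l e = cong₂ (λ u v → u * treeCoef P m * (occᶜ C (P (root m)) + v)) (ctxCoef-cong C l e) (e (P (root m)))
    ctxCoef-cong (m ▷ C) l e = cong (λ u → treeCoef P m * u * occᴹ (P (rootᶜ C l)) m) (ctxCoef-cong C l e)

    treeCoef-preLie : ∀ a b d → treeCoef P ((a · b) · d) + treeCoef P (a · (d · b)) ≡ treeCoef P ((a · d) · b) + treeCoef P (a · (b · d))
    treeCoef-preLie a b d = begin
      (la * lb * pa) * ld * (qa + qb) + la * (ld * lb * pd) * qa ≡⟨ solve 7 (λ la lb ld pa pd qa qb →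
           (la :* lb :* pa) :* ld :* (qa :+ qb) :+ la :* (ld :* lb :* pd) :* qa :=
           (la :* ld :* qa) :* lb :* (pa :+ pd) :+ la :* (lb :* ld :* qb) :* pa) refl la lb ld pa pd qa qb ⟩
      (la * ld * qa) * lb * (pa + pd) + la * (lb * ld * qb) * pa ∎
      where
      open Relation.Binary.PropositionalEquality.≡-Reasoning
      la lb ld pa pd qa qb : ℕ
      la = treeCoef P a
      lb = treeCoef P b
      ld = treeCoef P d
      pa = occᴹ (P (root b)) a
      pd = occᴹ (P (root b)) d
      qa = occᴹ (P (root d)) a
      qb = occᴹ (P (root d)) b

    -- The four terms have the same label counts and root, so the context contributes the same factor to each.
    treeCoef-preLie-plug : ∀ C a b d → treeCoef P (plug C ((a · b) · d)) + treeCoef P (plug C (a · (d · b))) ≡ treeCoef P (plug C ((a · d) · b)) + treeCoef P (plug C (a · (b · d)))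
    treeCoef-preLie-plug C a b d = begin
      treeCoef P (plug C ((a · b) · d)) + treeCoef P (plug C (a · (d · b))) ≡⟨ cong₂ _+_ (treeCoef-plug C ((a · b) · d)) (treeCoef-plug C (a · (d · b))) ⟩
      ctxCoef C f1 l * treeCoef P ((a · b) · d) + ctxCoef C f4 l * treeCoef P (a · (d · b)) ≡⟨ cong (λ u → ctxCoef C f1 l * treeCoef P ((a · b) · d) + u * treeCoef P (a · (d · b))) (ctxCoef-cong C l e4) ⟩
      ctxCoef C f1 l * treeCoef P ((a · b) · d) + ctxCoef C f1 l * treeCoef P (a · (d · b)) ≡⟨ sym (*-distribˡ-+ (ctxCoef C f1 l) _ _) ⟩
      ctxCoef C f1 l * (treeCoef P ((a · b) · d) + treeCoef P (a · (d · b))) ≡⟨ cong (ctxCoef C f1 l *_) (treeCoef-preLie a b d) ⟩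
      ctxCoef C f1 l * (treeCoef P ((a · d) · b) + treeCoef P (a · (b · d))) ≡⟨ *-distribˡ-+ (ctxCoef C f1 l) _ _ ⟩
      ctxCoef C f1 l * treeCoef P ((a · d) · b) + ctxCoef C f1 l * treeCoef P (a · (b · d)) ≡⟨ cong₂ (λ u v → u * treeCoef P ((a · d) · b) + v * treeCoef P (a · (b · d))) (ctxCoef-cong C l e3) (ctxCoef-cong C l e2) ⟩
      ctxCoef C f3 l * treeCoef P ((a · d) · b) + ctxCoef C f2 l * treeCoef P (a · (b · d)) ≡⟨ sym (cong₂ _+_ (treeCoef-plug C ((a · d) · b)) (treeCoef-plug C (a · (b · d)))) ⟩
      treeCoef P (plug C ((a · d) · b)) + treeCoef P (plug C (a · (b · d))) ∎
      where
      open Relation.Binary.PropositionalEquality.≡-Reasoning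
      l : Fin n
      l = root a
      f1 f2 f3 f4 : Fin n → ℕ
      f1 q = occᴹ q ((a · b) · d)
      f2 q = occᴹ q (a · (b · d))
      f3 q = occᴹ q ((a · d) · b)
      f4 q = occᴹ q (a · (d · b))
      e4 : ∀ q → f4 q ≡ f1 q
      e4 q = solve 3 (λ x y z → x :+ (z :+ y) := x :+ y :+ z) refl (occᴹ q a) (occᴹ q b) (occᴹ q d)
      e3 : ∀ q → f1 q ≡ f3 q
      e3 q = solve 3 (λ x y z → x :+ y :+ z := x :+ z :+ y) refl (occᴹ q a) (occᴹ q b) (occᴹ q d)
      e2 : ∀ q → f1 q ≡ f2 q
      e2 q = solve 3 (λ x y z → x :+ y :+ z := x :+ (y :+ z)) refl (occᴹ q a) (occᴹ q b) (occᴹ q d)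

module LeadingTreeOfΘ where

  open Occurrences
  open RootedTrees
  open import Data.Nat as ℕ using (ℕ; _+_; _≤_; _<_)
  open import Data.Nat.Properties
  open import Data.Fin as Fin using (Fin; toℕ)
  open import Data.List using (allFin)
  open import Data.Product using (_×_; _,_; Σ; proj₁; proj₂; uncurry)
  open import Data.Sum using (inj₁; inj₂)
  open import Data.Unit using (⊤; tt)
  open import Relation.Nullary using (yes; no)
  open import Relation.Binary.PropositionalEquality using (_≡_; _≢_; refl; sym; trans; cong; cong₂; subst)
  open import Data.Empty using (⊥; ⊥-elim)
  open import Data.Fin.Properties using (toℕ-injective)
  open import Function using (_∘_)

  module _ {n : ℕ} where

    data RightFactor : BTree n → BTree n → Set where
      rf-here : ∀ {L R} → RightFactor R (node 𝟙 L R)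
      rf-there : ∀ {G L R} → RightFactor G L → RightFactor G (node 𝟙 L R)

    LeftComb : BTree n → Set
    LeftComb (leaf _) = ⊤
    LeftComb (node Fin.zero _ _) = ⊥
    LeftComb (node (Fin.suc _) L _) = LeftComb L

    leftComb : ∀ L R → IsPointedLyndon (node 𝟙 L R) → LeftComb L
    leftComb (leaf _) R _ = tt
    leftComb (node Fin.zero L₂ R₂) R (_ , (() , _) , _)
    leftComb (node 𝟙 L₂ R₂) R (_ , _ , pL , _) = leftComb L₂ R₂ pL
    leftComb (node (Fin.suc (Fin.suc ())) L₂ R₂) R _

    root-Θ≡ν : ∀ T → LeftComb T → IsPointedLyndon T → toℕ (root (Θ T)) ≡ ν T
    root-Θ≡ν (leaf a) _ _ = refl
    root-Θ≡ν (node 𝟙 L R) c (nT , _ , pL , _) = trans (root-Θ≡ν L c pL) (sym nT)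
    root-Θ≡ν (node (Fin.suc (Fin.suc ())) L R) c _

    ∈ᴹΘ⇒∈ᵀ : ∀ {a : Fin n} (T : BTree n) → a ∈ᴹ Θ T → a ∈ᵀ T
    ∈ᴹΘ⇒∈ᵀ {a} T h = subst (1 ≤_) (sym (occᵀ-Θ a T)) h

    ∈ᵀ⇒∈ᴹΘ : ∀ {a : Fin n} (T : BTree n) → a ∈ᵀ T → a ∈ᴹ Θ T
    ∈ᵀ⇒∈ᴹΘ {a} T h = subst (1 ≤_) (occᵀ-Θ a T) h

    root-Θ-colour0≢ν : ∀ L R → IsPointedLyndon (node Fin.zero L R) → (∀ a → occᵀ a L + occᵀ a R ≤ 1) → toℕ (root (Θ (node Fin.zero L R))) ≢ ν (node Fin.zero L R)
    root-Θ-colour0≢ν L R (nT , _) d e with ν-attained L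
    ... | z , hz , ez with toℕ-injective (trans e (trans nT ez))
    ... | refl = 1≰0 (subst (1 ≤_) (+≤1⇒absentʳ (occᵀ z L) (occᵀ z R) (d z) hz) (∈ᴹΘ⇒∈ᵀ R (root-occurs (Θ R))))

    rightFactor-containing : ∀ L → LeftComb L → ∀ z → z ∈ᴹ Θ L → z ≢ root (Θ L) → Σ (BTree n) λ G → RightFactor G L × (z ∈ᴹ Θ G)
    rightFactor-containing (leaf a) c z h ne = ⊥-elim (ne (indicator-pos (_ Fin.≟ _) h))
    rightFactor-containing (node 𝟙 L₂ R₂) c z h ne with 1≤+⇒1≤⊎1≤ (occᴹ z (Θ L₂)) (occᴹ z (Θ R₂)) h
    ... | inj₂ hr = R₂ , rf-here , hr
    ... | inj₁ hl with rightFactor-containing L₂ c z hl ne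
    ...   | G , f , hg = G , rf-there f , hg
    rightFactor-containing (node (Fin.suc (Fin.suc ())) L₂ R₂) c z h ne

    rightFactor-ν : ∀ L R' G → IsPointedLyndon (node 𝟙 L R') → RightFactor G L → ν R' < ν G
    rightFactor-ν (node .𝟙 L₂ R₂) R' .R₂ (_ , (_ , lyn) , _) rf-here = lyn refl refl
    rightFactor-ν (node .𝟙 L₂ R₂) R' G (_ , (_ , lyn) , pL , _) (rf-there f) = <-trans (lyn refl refl) (rightFactor-ν L₂ R₂ G pL f)

    AtMostOnceᵀ : BTree n → Set
    AtMostOnceᵀ T = ∀ a → occᵀ a T ≤ 1

    atMostOnce-Θ : ∀ T → AtMostOnceᵀ T → AtMostOnce (Θ T)
    atMostOnce-Θ T d = mkAtMostOnce λ a → subst (_≤ 1) (occᵀ-Θ a T) (d a)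

    -- The least label z of R lies in Θ R but not in Θ R', hence in a right factor G of the left comb L'; so ν R' < ν G ≤ z = ν R.
    colour1-rightRoot-≢⇒ν< : ∀ {P} (L R L' R' : BTree n) → IsPointedLyndon (node 𝟙 L R) → IsPointedLyndon (node 𝟙 L' R') →
      (d : AtMostOnce (Θ L · Θ R)) (d' : AtMostOnce (Θ L' · Θ R')) → ParentsAgree P (Θ L · Θ R) → ParentsAgree P (Θ L' · Θ R') →
      root (Θ L) ≡ root (Θ L') → (∀ a → occᴹ a (Θ L) + occᴹ a (Θ R) ≡ occᴹ a (Θ L') + occᴹ a (Θ R')) →
      root (Θ R) ≢ root (Θ R') → ν R' < ν R
    colour1-rightRoot-≢⇒ν< L R L' R' pT pT' d d' ag ag' root-ℓ same ne with ν-attained R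
    ... | z , z∈R , νR≡z
        with uncurry (rightFactor-containing L' (leftComb L' R' pT') z)
                     (SameParents.rightFactor-moves (Θ L) (Θ R) (Θ L') (Θ R') d d' ag ag' root-ℓ same ne z (∈ᵀ⇒∈ᴹΘ R z∈R))
    ... | G , G⊑L' , z∈G = <-≤-trans (rightFactor-ν L' R' G pT' G⊑L') (subst (ν G ≤_) (sym νR≡z) (ν≤occurring z G (∈ᴹΘ⇒∈ᵀ G z∈G)))

    leaf≉node : ∀ a u (L R : BTree n) → (∀ x → occᵀ x (node u L R) ≡ occᵀ x (leaf a)) → ⊥
    leaf≉node a u L R e with ν-attained L | ν-attained R
    ... | x , hx , _ | y , hy , _ with indicator-pos (x Fin.≟ a) (subst (1 ≤_) (e x) (≤-trans hx (m≤m+n _ _)))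
                                     | indicator-pos (y Fin.≟ a) (subst (1 ≤_) (e y) (≤-trans hy (m≤n+m _ _)))
    ... | refl | refl = 1≰0 (subst (1 ≤_) (+≤1⇒absentʳ (occᵀ a L) (occᵀ a R) (subst (_≤ 1) (sym (e a)) (indicator≤1 (a Fin.≟ a))) hx) hy)

    common-minimum : ∀ u u' (L R L' R' : BTree n) → ν (node u L R) ≡ ν L → ν (node u' L' R') ≡ ν L' →
                     (∀ a → occᵀ a (node u L R) ≡ occᵀ a (node u' L' R')) → Σ (Fin n) λ z → z ∈ᵀ L × z ∈ᵀ L'
    common-minimum u u' L R L' R' nT nT' e with ν-attained L | ν-attained L'
    ... | z , hz , ez | z' , hz' , ez' with toℕ-injective (trans (sym ez) (trans (sym nT) (trans (ν-cong (node u L R) (node u' L' R') e) (trans nT' ez'))))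
    ... | refl = z , hz , hz'

    Θ-occurrences : ∀ (T T' : BTree n) → (∀ a → occᵀ a T ≡ occᵀ a T') → ∀ a → occᴹ a (Θ T) ≡ occᴹ a (Θ T')
    Θ-occurrences T T' e a = trans (sym (occᵀ-Θ a T)) (trans (e a) (occᵀ-Θ a T'))

    Θ-occurrences⁻ : ∀ (T T' : BTree n) → (∀ a → occᴹ a (Θ T) ≡ occᴹ a (Θ T')) → ∀ a → occᵀ a T ≡ occᵀ a T'
    Θ-occurrences⁻ T T' e a = trans (occᵀ-Θ a T) (trans (e a) (sym (occᵀ-Θ a T')))

    atMostOnceᵀ-left : ∀ u (L R : BTree n) → AtMostOnceᵀ (node u L R) → AtMostOnceᵀ L
    atMostOnceᵀ-left u L R d a = ≤-trans (m≤m+n (occᵀ a L) _) (d a)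

    atMostOnceᵀ-right : ∀ u (L R : BTree n) → AtMostOnceᵀ (node u L R) → AtMostOnceᵀ R
    atMostOnceᵀ-right u L R d a = ≤-trans (m≤n+m (occᵀ a R) _) (d a)

    Θ-injective : ∀ {P} (T T' : BTree n) → IsPointedLyndon T → IsPointedLyndon T' → (∀ a → occᵀ a T ≡ occᵀ a T') → AtMostOnceᵀ T →
          root (Θ T) ≡ root (Θ T') → ParentsAgree P (Θ T) → ParentsAgree P (Θ T') → T ≡ T'
    Θ-injective (leaf a) (leaf b) _ _ e _ _ _ _ = cong leaf (indicator-pos (_ Fin.≟ _) (subst (1 ≤_) (e a) (≤-reflexive (sym (indicator-yes (a Fin.≟ a) refl)))))
    Θ-injective (leaf a) (node u L R) _ _ e _ _ _ _ = ⊥-elim (leaf≉node a u L R (λ x → sym (e x)))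
    Θ-injective (node u L R) (leaf a) _ _ e _ _ _ _ = ⊥-elim (leaf≉node a u L R e)
    Θ-injective (node (Fin.suc (Fin.suc ())) L R) _ _ _ _ _ _ _ _
    Θ-injective (node _ L R) (node (Fin.suc (Fin.suc ())) L' R') _ _ _ _ _ _ _
    Θ-injective (node Fin.zero L R) (node 𝟙 L' R') pT pT' e dT rt _ _ =
      ⊥-elim (root-Θ-colour0≢ν L R pT dT (trans (cong toℕ rt) (trans (root-Θ≡ν (node 𝟙 L' R') (leftComb L' R' pT') pT') (sym (ν-cong (node Fin.zero L R) (node 𝟙 L' R') e)))))
    Θ-injective (node 𝟙 L R) (node Fin.zero L' R') pT pT' e dT rt _ _ =
      ⊥-elim (root-Θ-colour0≢ν L' R' pT' (λ a → subst (_≤ 1) (e a) (dT a)) (trans (cong toℕ (sym rt)) (trans (root-Θ≡ν (node 𝟙 L R) (leftComb L R pT) pT) (ν-cong (node 𝟙 L R) (node Fin.zero L' R') e))))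
    Θ-injective (node Fin.zero L R) (node Fin.zero L' R') (nT , _ , pL , pR) (nT' , _ , pL' , pR') e dT rt ag ag' =
      cong₂ (node Fin.zero)
        (Θ-injective L L' pL pL' (Θ-occurrences⁻ L L' (proj₂ ∘ same)) (atMostOnceᵀ-left Fin.zero L R dT) root-ℓ (parentsAgree-right d ag) (parentsAgree-right d' ag'))
        (Θ-injective R R' pR pR' (Θ-occurrences⁻ R R' (proj₁ ∘ same)) (atMostOnceᵀ-right Fin.zero L R dT) rt (parentsAgree-left d ag) (parentsAgree-left d' ag'))
      where
      d : AtMostOnce (Θ (node Fin.zero L R))
      d = atMostOnce-Θ (node Fin.zero L R) dT
      d' : AtMostOnce (Θ (node Fin.zero L' R'))
      d' = atMostOnce-Θ (node Fin.zero L' R') (λ a → subst (_≤ 1) (e a) (dT a))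
      root-ℓ : root (Θ L) ≡ root (Θ L')
      root-ℓ with common-minimum Fin.zero Fin.zero L R L' R' nT nT' e
      ... | z , z∈L , z∈L' = SameParents.rightRoot-≡ (Θ R) (Θ L) (Θ R') (Θ L') d d' ag ag' rt z (∈ᵀ⇒∈ᴹΘ L z∈L) (∈ᵀ⇒∈ᴹΘ L' z∈L')
      same : ∀ a → (occᴹ a (Θ R) ≡ occᴹ a (Θ R')) × (occᴹ a (Θ L) ≡ occᴹ a (Θ L'))
      same = factors-same-occurrences (Θ R) (Θ L) (Θ R') (Θ L') d d' ag ag' rt root-ℓ (Θ-occurrences (node Fin.zero L R) (node Fin.zero L' R') e)
    Θ-injective (node 𝟙 L R) (node 𝟙 L' R') pT@(_ , _ , pL , pR) pT'@(_ , _ , pL' , pR') e dT rt ag ag' =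
      cong₂ (node 𝟙)
        (Θ-injective L L' pL pL' (Θ-occurrences⁻ L L' (proj₁ ∘ same)) (atMostOnceᵀ-left 𝟙 L R dT) rt (parentsAgree-left d ag) (parentsAgree-left d' ag'))
        (Θ-injective R R' pR pR' (Θ-occurrences⁻ R R' (proj₂ ∘ same)) (atMostOnceᵀ-right 𝟙 L R dT) root-ρ (parentsAgree-right d ag) (parentsAgree-right d' ag'))
      where
      d : AtMostOnce (Θ (node 𝟙 L R))
      d = atMostOnce-Θ (node 𝟙 L R) dT
      d' : AtMostOnce (Θ (node 𝟙 L' R'))
      d' = atMostOnce-Θ (node 𝟙 L' R') (λ a → subst (_≤ 1) (e a) (dT a))
      root-ρ : root (Θ R) ≡ root (Θ R')
      root-ρ with root (Θ R) Fin.≟ root (Θ R')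
      ... | yes q = q
      ... | no ne = ⊥-elim (<-asym (colour1-rightRoot-≢⇒ν< L R L' R' pT pT' d d' ag ag' rt (Θ-occurrences (node 𝟙 L R) (node 𝟙 L' R') e) ne)
                                   (colour1-rightRoot-≢⇒ν< L' R' L R pT' pT d' d ag' ag (sym rt) (λ a → sym (Θ-occurrences (node 𝟙 L R) (node 𝟙 L' R') e a)) (ne ∘ sym)))
      same : ∀ a → (occᴹ a (Θ L) ≡ occᴹ a (Θ L')) × (occᴹ a (Θ R) ≡ occᴹ a (Θ R'))
      same = factors-same-occurrences (Θ L) (Θ R) (Θ L') (Θ R') d d' ag ag' rt root-ρ (Θ-occurrences (node 𝟙 L R) (node 𝟙 L' R') e)

    totalDepth : Mag n → ℕ
    totalDepth m = sumOver (depth m) (allFin n)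

    treeCoef-parent-self : ∀ T → AtMostOnceᵀ T → treeCoef (parent (Θ T)) (Θ T) ≡ 1
    treeCoef-parent-self T d = parentsAgree⇒treeCoef≡1 (Θ T) (atMostOnce-Θ T d) (λ _ _ _ → refl)

    module _ (T T' : BTree n) (pT : IsPointedLyndon T) (pT' : IsPointedLyndon T')
             (c : ∀ a → occᵀ a T ≡ 1) (c' : ∀ a → occᵀ a T' ≡ 1) where

      private
        d : AtMostOnce (Θ T)
        d = atMostOnce-Θ T (λ a → ≤-reflexive (c a))
        d' : AtMostOnce (Θ T')
        d' = atMostOnce-Θ T' (λ a → ≤-reflexive (c' a))
        ∈Θ : ∀ v → v ∈ᴹ Θ T
        ∈Θ v = ∈ᵀ⇒∈ᴹΘ T (≤-reflexive (sym (c v)))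
        ∈Θ' : ∀ v → v ∈ᴹ Θ T'
        ∈Θ' v = ∈ᵀ⇒∈ᴹΘ T' (≤-reflexive (sym (c' v)))
        open DepthBound (parent (Θ T)) (depth (Θ T)) (root (Θ T)) (parent-root (Θ T) d) (λ w ne' → depth-parent (Θ T) d w (∈Θ w) ne')

      realises-parent⇒≡ : Realises (parent (Θ T)) (Θ T') → T' ≡ T
      realises-parent⇒≡ r = Θ-injective T' T pT' pT (λ a → trans (c' a) (sym (c a))) (λ a → ≤-reflexive (c' a)) same-root ag (λ _ _ _ → refl)
        where
        ag : ParentsAgree (parent (Θ T)) (Θ T')
        ag = realises⇒parentsAgree (Θ T') d' r
        same-root : root (Θ T') ≡ root (Θ T)
        same-root with root (Θ T') Fin.≟ root (Θ T)
        ... | yes q = q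
        ... | no ne = ⊥-elim (parent-≢ (Θ T') d' (root (Θ T)) (∈Θ' _) (ne ∘ sym)
                         (trans (sym (ag (root (Θ T)) (∈Θ' _) (ne ∘ sym))) (parent-root (Θ T) d)))

      treeCoef-triangular : T' ≢ T → treeCoef (parent (Θ T)) (Θ T') ≢ 0 → totalDepth (Θ T') < totalDepth (Θ T)
      treeCoef-triangular ne nz with realises? (parent (Θ T)) (Θ T')
      ... | yes r = ⊥-elim (ne (realises-parent⇒≡ r))
      ... | no ¬r with depth+< (Θ T') d' nz ¬r
      ... | u , _ , lt = sumOver-strict (depth (Θ T')) (depth (Θ T)) (allFin n) u pointwise (≤-reflexive (sym (occ-allFin u))) (≤-<-trans (m≤m+n _ _) lt)
        where
        pointwise : ∀ v → depth (Θ T') v ≤ depth (Θ T) v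
        pointwise v = ≤-trans (m≤m+n _ _) (depth+≤ (Θ T') d' nz v (∈Θ' v))

module Independence {c ℓ} (F : Field c ℓ) where

  open Occurrences
  open RootedTrees
  open LeadingTreeOfΘ
  open TreeCoefficientPreLie
  open PreLieIdeal F
  open import Data.Nat as ℕ using (ℕ; zero; suc)
  import Data.Nat.Properties as NP
  open import Data.Fin as Fin using (Fin)
  open import Data.List using (List; []; _∷_; _++_; map; allFin; deduplicate)
  open import Data.List.Relation.Unary.All as All using (All; []; _∷_)
  open import Data.List.Relation.Unary.AllPairs using ([]; _∷_)
  open import Data.List.Relation.Unary.Unique.Propositional using (Unique)
  import Data.List.Relation.Unary.Unique.DecPropositional.Properties as UDP
  open import Data.List.Membership.Propositional using (_∈_)
  open import Data.List.Membership.Propositional.Properties using (∈-map⁺; ∈-++⁺ˡ; ∈-++⁺ʳ; ∈-deduplicate⁺)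
  open import Data.List.Relation.Unary.Any using (here; there)
  open import Data.List.Relation.Binary.Permutation.Propositional using (_↭_)
  open import Data.Product using (_×_; _,_; proj₁; proj₂)
  open import Relation.Nullary using (yes; no)
  import Relation.Binary.PropositionalEquality as ≡
  open ≡ using (_≡_; _≢_)
  open import Data.Empty using (⊥-elim)

  open Field F
  open FreeAlgebra F
  open ThetaComb F
  open import Relation.Binary.Reasoning.Setoid setoid
  open import Algebra.Properties.CommutativeSemigroup +-commutativeSemigroup using () renaming (interchange to +-interchange)
  open import Algebra.Properties.Monoid.Mult +-monoid using (×-homo-1; ×-homo-+) renaming (_×_ to _×ₙ_)

  ι : ℕ → Carrier
  ι k = k ×ₙ 1#

  ι-+ : ∀ a b → ι (a ℕ.+ b) ≈ ι a + ι b
  ι-+ = ×-homo-+ 1#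

  relator-value≈0 : ∀ x y z weight → x + weight ≈ z + y → 1# * x + (−1# * y + (−1# * z + (1# * weight + 0#))) ≈ 0#
  relator-value≈0 x y z weight e = begin
    1# * x + (−1# * y + (−1# * z + (1# * weight + 0#))) ≈⟨ +-cong (*-identityˡ x) (+-congˡ (+-congˡ (trans (+-identityʳ _) (*-identityˡ weight)))) ⟩
    x + (−1# * y + (−1# * z + weight)) ≈⟨ +-congˡ (sym (+-assoc _ _ _)) ⟩
    x + ((−1# * y + −1# * z) + weight) ≈⟨ +-congˡ (+-comm _ _) ⟩
    x + (weight + (−1# * y + −1# * z)) ≈⟨ sym (+-assoc _ _ _) ⟩
    (x + weight) + (−1# * y + −1# * z) ≈⟨ +-cong e (sym (distribˡ −1# y z)) ⟩
    (z + y) + −1# * (y + z) ≈⟨ +-congʳ (+-comm z y) ⟩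
    (y + z) + −1# * (y + z) ≈⟨ x+−1x≈0 _ ⟩
    0# ∎

  module _ {n : ℕ} (P : Fin n → Fin n) where

    weight : Mag n → Carrier
    weight m = ι (treeCoef P m)

    Λ : Lin n → Carrier
    Λ [] = 0#
    Λ ((k , x) ∷ u) = k * weight x + Λ u

    Λ-++ : ∀ (u v : Lin n) → Λ (u ++ v) ≈ Λ u + Λ v
    Λ-++ [] v = sym (+-identityˡ _)
    Λ-++ ((k , x) ∷ u) v = trans (+-congˡ (Λ-++ u v)) (sym (+-assoc _ _ _))

    Λ-scale : ∀ k (u : Lin n) → Λ (scale k u) ≈ k * Λ u
    Λ-scale k [] = sym (zeroʳ k)
    Λ-scale k ((a , x) ∷ u) = begin
      (k * a) * weight x + Λ (scale k u) ≈⟨ +-cong (*-assoc k a _) (Λ-scale k u) ⟩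
      k * (a * weight x) + k * Λ u ≈⟨ sym (distribˡ k _ _) ⟩
      k * (a * weight x + Λ u) ∎

    Λ-evalGen : ∀ (g : IdealGen n) → Λ (evalGen g) ≈ 0#
    Λ-evalGen (k , C , a , b , d) = begin
      Λ (scale k (mapMon (plug C) (relator a b d))) ≈⟨ Λ-scale k (mapMon (plug C) (relator a b d)) ⟩
      k * Λ (mapMon (plug C) (relator a b d)) ≈⟨ *-congˡ (relator-value≈0 _ _ _ _ balanced) ⟩
      k * 0# ≈⟨ zeroʳ k ⟩
      0# ∎
      where
      t : Mag n → ℕ
      t x = treeCoef P (plug C x)
      balanced : ι (t ((a · b) · d)) + ι (t (a · (d · b))) ≈ ι (t ((a · d) · b)) + ι (t (a · (b · d)))
      balanced = begin
        ι (t ((a · b) · d)) + ι (t (a · (d · b))) ≈⟨ sym (ι-+ (t ((a · b) · d)) _) ⟩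
        ι (t ((a · b) · d) ℕ.+ t (a · (d · b))) ≡⟨ ≡.cong ι (treeCoef-preLie-plug P C a b d) ⟩
        ι (t ((a · d) · b) ℕ.+ t (a · (b · d))) ≈⟨ ι-+ (t ((a · d) · b)) _ ⟩
        ι (t ((a · d) · b)) + ι (t (a · (b · d))) ∎

    Λ-evalGens : ∀ (gs : List (IdealGen n)) → Λ (evalGens gs) ≈ 0#
    Λ-evalGens [] = refl
    Λ-evalGens (g ∷ gs) = trans (Λ-++ (evalGen g) (evalGens gs)) (trans (+-cong (Λ-evalGen g) (Λ-evalGens gs)) (+-identityˡ 0#))

    sumOn : List (Mag n) → (Mag n → Carrier) → Carrier
    sumOn [] g = 0#
    sumOn (m ∷ S) g = g m + sumOn S g

    sumOn-cong : ∀ S {g h : Mag n → Carrier} → (∀ m → g m ≈ h m) → sumOn S g ≈ sumOn S h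
    sumOn-cong [] e = refl
    sumOn-cong (m ∷ S) e = +-cong (e m) (sumOn-cong S e)

    sumOn-+ : ∀ S (g h : Mag n → Carrier) → sumOn S (λ m → g m + h m) ≈ sumOn S g + sumOn S h
    sumOn-+ [] g h = sym (+-identityˡ 0#)
    sumOn-+ (m ∷ S) g h = trans (+-congˡ (sumOn-+ S g h)) (+-interchange _ _ _ _)

    sumOn-0 : ∀ S → sumOn S (λ m → 0# * weight m) ≈ 0#
    sumOn-0 [] = refl
    sumOn-0 (m ∷ S) = trans (+-cong (zeroˡ _) (sumOn-0 S)) (+-identityˡ 0#)

    ifYesWeighted : Mag n → Carrier → Mag n → Carrier
    ifYesWeighted x k m = ifYes {n} (x ≟ᴹ m) k * weight m

    sumOn-absent : ∀ S x k → All (x ≢_) S → sumOn S (ifYesWeighted x k) ≈ 0#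
    sumOn-absent [] x k [] = refl
    sumOn-absent (m ∷ S) x k (ne ∷ h) with x ≟ᴹ m
    ... | yes e = ⊥-elim (ne e)
    ... | no _ = trans (+-cong (zeroˡ _) (sumOn-absent S x k h)) (+-identityˡ 0#)

    sumOn-single : ∀ S x k → Unique S → x ∈ S → sumOn S (ifYesWeighted x k) ≈ k * weight x
    sumOn-single (m ∷ S) x k (hm ∷ u) (here ≡.refl) with x ≟ᴹ x
    ... | yes _ = trans (+-congˡ (sumOn-absent S x k hm)) (+-identityʳ _)
    ... | no ne = ⊥-elim (ne ≡.refl)
    sumOn-single (m ∷ S) x k (hm ∷ u) (there p) with x ≟ᴹ m
    ... | yes ≡.refl = ⊥-elim (All.lookup hm p ≡.refl)
    ... | no _ = trans (+-cong (zeroˡ _) (sumOn-single S x k u p)) (+-identityˡ _)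

    Λ-sumOn : ∀ (u : Lin n) S → Unique S → All (λ e → proj₂ e ∈ S) u → Λ u ≈ sumOn S (λ m → coef u m * weight m)
    Λ-sumOn [] S uq _ = sym (sumOn-0 S)
    Λ-sumOn ((k , x) ∷ u) S uq (hx ∷ hu) = begin
      k * weight x + Λ u ≈⟨ +-cong (sym (sumOn-single S x k uq hx)) (Λ-sumOn u S uq hu) ⟩
      sumOn S (ifYesWeighted x k) + sumOn S (λ m → coef u m * weight m) ≈⟨ sym (sumOn-+ S _ _) ⟩
      sumOn S (λ m → ifYesWeighted x k m + coef u m * weight m) ≈⟨ sumOn-cong S (λ m → trans (sym (distribʳ (weight m) _ _)) (*-congʳ (sym (coef-∷ k x u m)))) ⟩
      sumOn S (λ m → coef ((k , x) ∷ u) m * weight m) ∎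

    Λ-≈ : ∀ (u v : Lin n) → u ≈ᴸ v → Λ u ≈ Λ v
    Λ-≈ u v e = begin
      Λ u ≈⟨ Λ-sumOn u S uq (All.tabulate (λ e∈u → ∈-deduplicate⁺ _≟ᴹ_ (∈-map⁺ proj₂ (∈-++⁺ˡ e∈u)))) ⟩
      sumOn S (λ m → coef u m * weight m) ≈⟨ sumOn-cong S (λ m → *-congʳ (e m)) ⟩
      sumOn S (λ m → coef v m * weight m) ≈⟨ sym (Λ-sumOn v S uq (All.tabulate (λ e∈v → ∈-deduplicate⁺ _≟ᴹ_ (∈-map⁺ proj₂ (∈-++⁺ʳ u e∈v))))) ⟩
      Λ v ∎
      where
      S : List (Mag n)
      S = deduplicate (_≟ᴹ_ {n}) (map proj₂ (u ++ v))
      uq : Unique S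
      uq = UDP.deduplicate-! (_≟ᴹ_ {n}) (map proj₂ (u ++ v))

    Λ-ideal : ∀ (u : Lin n) → InIdeal u → Λ u ≈ 0#
    Λ-ideal u (gs , e) = trans (Λ-≈ u (evalGens gs) e) (Λ-evalGens gs)

  module _ {n : ℕ} where

    occ-tree≡1 : ∀ (T : BTree n) → leaves T ↭ allFin n → ∀ a → occᵀ a T ≡ 1
    occ-tree≡1 T q a = ≡.trans (countᵀ-leaves (a Fin.≟_) T) (≡.trans (count-↭ (a Fin.≟_) q) (occ-allFin a))

    Λ-zero : ∀ (P : Fin n → Fin n) (r : List (Carrier × BTree n)) →
              (∀ c' T' → (c' , T') ∈ r → c' * ι (treeCoef P (Θ T')) ≈ 0#) → Λ P (ΘLin r) ≈ 0#
    Λ-zero P [] h = refl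
    Λ-zero P ((c0 , T0) ∷ r) h = trans (+-cong (h c0 T0 (here ≡.refl)) (Λ-zero P r (λ c' T' m → h c' T' (there m)))) (+-identityʳ 0#)

    Λ-isolate : ∀ (P : Fin n → Fin n) c T (r : List (Carrier × BTree n)) → Unique (map proj₂ r) → (c , T) ∈ r →
              (∀ c' T' → (c' , T') ∈ r → T' ≢ T → c' * ι (treeCoef P (Θ T')) ≈ 0#) → Λ P (ΘLin r) ≈ c * ι (treeCoef P (Θ T))
    Λ-isolate P c T ((c0 , T0) ∷ r) (h ∷ u) (here ≡.refl) hyp =
      trans (+-congˡ (Λ-zero P r (λ c' T' m → hyp c' T' (there m) (λ e → All.lookup h (∈-map⁺ proj₂ m) (≡.sym e))))) (+-identityʳ _)
    Λ-isolate P c T ((c0 , T0) ∷ r) (h ∷ u) (there m) hyp =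
      trans (+-congʳ (hyp c0 T0 (here ≡.refl) (λ e → All.lookup h (∈-map⁺ proj₂ m) e))) (trans (+-identityˡ _) (Λ-isolate P c T r u m (λ c' T' m' → hyp c' T' (there m'))))

    independence : ∀ (ts : List (Carrier × BTree n)) → All (λ p → InTLyn n (proj₂ p)) ts → Unique (map proj₂ ts) →
            InIdeal (ΘLin ts) → All (λ p → proj₁ p ≈ 0#) ts
    independence ts allT uq ideal = All.tabulate (λ {p} mem → coefficient≈0 (suc (totalDepth (Θ (proj₂ p)))) (proj₁ p) (proj₂ p) mem (NP.n<1+n _))
      where
      coefficient≈0 : ∀ k c T → (c , T) ∈ ts → totalDepth (Θ T) ℕ.< k → c ≈ 0#
      coefficient≈0 zero c T mem ()
      coefficient≈0 (suc k) c T mem lt = begin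
          c ≈⟨ sym (*-identityʳ c) ⟩
          c * 1# ≈⟨ *-congˡ (sym (×-homo-1 1#)) ⟩
          c * ι 1 ≈⟨ *-congˡ (reflexive (≡.cong ι (≡.sym (treeCoef-parent-self T (λ a → NP.≤-reflexive (cT1 a)))))) ⟩
          c * ι (treeCoef P (Θ T)) ≈⟨ sym (Λ-isolate P c T ts uq mem hyp) ⟩
          Λ P (ΘLin ts) ≈⟨ Λ-ideal P (ΘLin ts) ideal ⟩
          0# ∎
        where
        P : Fin n → Fin n
        P = parent (Θ T)
        iT : InTLyn n T
        iT = All.lookup allT mem
        cT1 : ∀ a → occᵀ a T ≡ 1
        cT1 = occ-tree≡1 T (proj₂ iT)
        hyp : ∀ c' T' → (c' , T') ∈ ts → T' ≢ T → c' * ι (treeCoef P (Θ T')) ≈ 0#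
        hyp c' T' mem' ne with treeCoef P (Θ T') ℕ.≟ 0
        ... | yes e = trans (*-congˡ (reflexive (≡.cong ι e))) (zeroʳ c')
        ... | no nz = trans (*-congʳ (coefficient≈0 k c' T' mem' (NP.<-≤-trans (treeCoef-triangular T T' (proj₁ iT) (proj₁ iT') cT1 (occ-tree≡1 T' (proj₂ iT')) ne nz) (NP.≤-pred lt)))) (zeroˡ _)
          where
          iT' : InTLyn n T'
          iT' = All.lookup allT mem'


theorem4p4 : ∀ {c ℓ} (F : Field c ℓ) (n : ℕ) → 1 ≤ n →
  let open Field F
      open FreeAlgebra F
      open ThetaComb F
  in
  -- spanning: every multilinear monomial is, modulo the pre-Lie ideal,
  -- a linear combination of Θ(T), T ∈ TLyn•_n
  ((m : Mag n) → Multilinear m →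
     ∃ λ (ts : List (Carrier × BTree n)) →
       All (λ p → InTLyn n (proj₂ p)) ts ×
       InIdeal (((1# , m) ∷ []) −ᴸ ΘLin ts))
  ×
  -- linear independence: a combination of Θ(T) over distinct T ∈ TLyn•_n
  -- lying in the pre-Lie ideal has all coefficients zero
  ((ts : List (Carrier × BTree n)) →
     All (λ p → InTLyn n (proj₂ p)) ts →
     Unique (map proj₂ ts) →
     InIdeal (ΘLin ts) →
     All (λ p → proj₁ p ≈ 0#) ts)
theorem4p4 F n _ = Spanning.spanning F {n} , Independence.independence F {n}
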